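{- Let $G=\operatorname{Dih}(A)$ where $A$ is a finite abelian group of odd order and $d(A)=2$. Then for structure classes $X_I$ of $\text{GEN}(G)$, \[ \operatorname{type}(X_I)=\begin{cases}(1,2,1) & \text{if } X_I\in\mathcal{O}_1,\\ (1,3,0) & \text{if } X_I\in\mathcal{O}_2,\\ (1,3,1) & \text{if } X_I\in\mathcal{O}_3.\end{cases} \]
   Context: $d(A)$ is the minimum size of a generating set of $A$. $\operatorname{Dih}(A)=C_2\ltimes A$ with $C_2=\{1,x\}$ and $x$ acting on $A$ by inversion. For a finite group $G$, $\text{GEN}(G)$ is the impartial game whose positions are the non-generating subsets of $G$ (nonterminal) and the generating sets $S$ having some $g\in S$ with $\langle S\setminus\{g\}\rangle\ne G$ (terminal); the start is $\emptyset$, the options of a nonterminal $P$ are $P\cup\{g\}$ for $g\in G\setminus P$, and terminal positions have no options. $\operatorname{nim}(P)=\operatorname{mex}\{\operatorname{nim}(Q):Q \text{ an option of } P\}$. Let $\mathcal{M}$ be the set of maximal subgroups of $G$ and $\mathcal{I}=\{\cap\mathcal{N}:\emptyset\neq\mathcal{N}\subseteq\mathcal{M}\}$. For $I\in\mathcal{I}$, $X_I$ is the set of subsets of $I$ not contained in any $J\in\mathcal{I}$ with $J\subsetneq I$; $X_G$ is the set of terminal positions. $X_I$ is odd (even) if $|I|$ is odd (even); $\operatorname{pty}(X_I)$ is $1$ if $|I|$ is odd and $0$ if even. The type of $X_I$ is $(\operatorname{pty}(X_I),\operatorname{nim}(P),\operatorname{nim}(Q))$ where $P,Q\in X_I$ with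 $|P|$ even and $|Q|$ odd (this does not depend on the choice of $P,Q$). The deficiency $\delta(P)$ of $P\subseteq G$ is the minimum size of $Q\subseteq G$ with $\langle P\cup Q\rangle=G$, and $\delta(X_I):=\delta(I)$. $\mathcal{O}_m$ is the set of odd structure classes $X_I$, $I\in\mathcal{I}\cup\{G\}$, with $\delta(X_I)=m$. -}

module Defs where

open import Data.Nat using (ℕ; zero; suc; _*_; _≤_; _<_; _%_)
open import Data.Nat.Divisibility using (_∣_)
open import Data.Fin using (Fin; zero; suc; combine; remQuot)
open import Data.Fin.Subset using (Subset; _∈_; _∉_; _⊆_; _⊂_; _∪_; ⁅_⁆; _-_; ∣_∣; ⋂; ⊤; ⊥)
open import Data.Product using (Σ; _×_; _,_; ∃)
open import Data.Sum using (_⊎_)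
open import Data.List using (List; []; _∷_)
open import Data.List.Relation.Unary.All using (All)
open import Relation.Binary.PropositionalEquality using (_≡_)
open import Relation.Nullary using (¬_)

Even : ℕ → Set
Even k = 2 ∣ k

Odd : ℕ → Set
Odd k = ¬ (2 ∣ k)

pty : ℕ → ℕ
pty k = k % 2

-- A finite group given by its multiplication table on Fin N.
-- (Only the operations are recorded here; the group laws are imposed
-- as hypotheses where needed.  The game notions below only use the
-- operations.)

record GroupTable : Set where
  field
    N   : ℕ
    _·_ : Fin N → Fin N → Fin N
    e   : Fin N
    inv : Fin N → Fin N

module _ (G : GroupTable) where
  open GroupTable G

  IsSubgroup : Subset N → Set
  IsSubgroup H = (e ∈ H)
               × (∀ x y → x ∈ H → y ∈ H → (x · y) ∈ H)
               × (∀ x → x ∈ H → inv x ∈ H)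

  _∈⟨_⟩ : Fin N → Subset N → Set
  x ∈⟨ P ⟩ = ∀ H → IsSubgroup H → P ⊆ H → x ∈ H

  Generates : Subset N → Set
  Generates P = ∀ x → x ∈⟨ P ⟩

  IsMaximal : Subset N → Set
  IsMaximal M = IsSubgroup M × M ⊂ ⊤
              × (∀ H → IsSubgroup H → M ⊆ H → H ≡ M ⊎ H ≡ ⊤)

  InI : Subset N → Set
  InI I = Σ (List (Subset N)) λ Ms →
            (¬ Ms ≡ []) × All IsMaximal Ms × I ≡ ⋂ Ms

  Terminal : Subset N → Set
  Terminal P = Generates P × (∃ λ g → g ∈ P × ¬ Generates (P - g))

  Position : Subset N → Set
  Position P = ¬ Generates P ⊎ Terminal P

  -- f is the nim-value function of GEN(G): for every position P,
  -- f P is the mex of the values of the options of P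
  -- (options of a nonterminal P are P ∪ {g}, g ∉ P; terminal positions
  -- have no options, so their value is mex ∅ = 0).
  IsNim : (Subset N → ℕ) → Set
  IsNim f = ∀ P → Position P →
      (Terminal P → f P ≡ 0)
    × (¬ Generates P →
          (∀ g → g ∉ P → ¬ f (P ∪ ⁅ g ⁆) ≡ f P)
        × (∀ m → m < f P → ∃ λ g → g ∉ P × f (P ∪ ⁅ g ⁆) ≡ m))

  StructIndex : Subset N → Set
  StructIndex I = InI I ⊎ I ≡ ⊤

  InX : Subset N → Subset N → Set
  InX I P = (I ≡ ⊤ × Terminal P)
          ⊎ (¬ I ≡ ⊤ × P ⊆ I × (∀ J → InI J → J ⊂ I → ¬ P ⊆ J))

  Deficiency : Subset N → ℕ → Set
  Deficiency P m = (∃ λ Q → ∣ Q ∣ ≡ m × Generates (P ∪ Q))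
                 × (∀ Q → Generates (P ∪ Q) → m ≤ ∣ Q ∣)

  MinGens : ℕ → Set
  MinGens m = (∃ λ S → ∣ S ∣ ≡ m × Generates S)
            × (∀ S → Generates S → m ≤ ∣ S ∣)

  HasType : (Subset N → ℕ) → Subset N → ℕ → ℕ → ℕ → Set
  HasType f I p a b = pty ∣ I ∣ ≡ p
                    × (∀ P → InX I P → Even ∣ P ∣ → f P ≡ a)
                    × (∀ Q → InX I Q → Odd ∣ Q ∣ → f Q ≡ b)

-- Dih(A) = C₂ ⋉ A, x acting by inversion.  An element a·x^b
-- (a ∈ A, b ∈ Fin 2) is encoded as combine b a : Fin (2 * n).
-- (a x^b)(a' x^c) = a a'^{(-1)^b} x^{b+c}.

module _ {n : ℕ} (_∘_ : Fin n → Fin n → Fin n) (eA : Fin n) (invA : Fin n → Fin n) where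

  private
    flip2 : Fin 2 → Fin 2
    flip2 zero = suc zero
    flip2 (suc _) = zero

    add2 : Fin 2 → Fin 2 → Fin 2
    add2 zero c = c
    add2 (suc _) c = flip2 c

    twist : Fin 2 → Fin n → Fin n
    twist zero a = a
    twist (suc _) a = invA a

    mulD : Fin (2 * n) → Fin (2 * n) → Fin (2 * n)
    mulD u v with remQuot {2} n u | remQuot {2} n v
    ... | (b , a) | (c , a') = combine (add2 b c) (a ∘ twist b a')

    invD : Fin (2 * n) → Fin (2 * n)
    invD u with remQuot {2} n u
    ... | (b , a) = combine b (twist b (invA a))

  Dih : GroupTable
  Dih = record { N = 2 * n ; _·_ = mulD ; e = combine {2} {n} zero eA ; inv = invD }

table : {n : ℕ} → (Fin n → Fin n → Fin n) → Fin n → (Fin n → Fin n) → GroupTable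
table {n} op e0 i0 = record { N = n ; _·_ = op ; e = e0 ; inv = i0 }

-- A non-generating position P of GEN(Dih A) is classified by its kind: whether it contains a
-- reflection, and its deficiency δ(P) ∈ {1, 2, 3} (d(A) ≤ 2, so a reflection together with two
-- rotations always generates).  For |A| odd, nim(P) is a function of the kind and the parity of
-- |P| (nimOf), proved by induction from the terminal positions.  An option P ∪ {g} flips the
-- parity and can only move to a few kinds (_⇝_), all of a different value; the smaller values are
-- attained by adding a reflection, a generator of A, or an element of ⟨P⟩ ∖ P.  The last exists
-- whenever |P| has the wrong parity for a subgroup of its kind: subgroups containing a reflection
-- ρ have even order (u ↦ uρ pairs them off), subgroups of rotations odd order (inversion fixes
-- only e, as A has no involutions).  Finally, a member of an odd class X_I contains no reflection
-- and has the same deficiency as I, so its kind is rotation_δ(I).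

module Submission where

open import Defs
open import Data.Nat using (ℕ; zero; suc; _+_; _*_; _∸_; _%_; _≤_; _<_; z≤n; s≤s; s≤s⁻¹)
open import Data.Nat.Properties
  using (suc-injective; ≤-trans; ≤-reflexive; ≤-refl; <-cmp; ∸-monoʳ-<; m<1+n⇒m<n∨m≡n; m+[n∸m]≡n)
open import Data.Nat.DivMod using (m%n<n)
open import Data.Nat.Divisibility using (_∣_; divides; m%n≡0⇒n∣m; m∣m*n)
open import Data.Nat.Induction using (<-rec)
open import Data.Bool using (Bool; true; false; not)
open import Data.Bool.Properties using (not-involutive) renaming (_≟_ to _≟ᵇ_)
open import Data.Fin using (Fin; zero; suc; combine; remQuot; _↑ˡ_)
open import Data.Fin.Properties
  using (any?; all?; splitAt-↑ˡ; splitAt-↑ʳ; combine-remQuot; combine-injective) renaming (_≟_ to _≟ᶠ_)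
open import Data.Fin.Subset
open import Data.Fin.Subset.Properties
open import Data.Vec using (_∷_; here; there; tabulate)
open import Data.Vec.Properties using (lookup∘tabulate; []=⇒lookup; lookup⇒[]=; ≡-dec)
open import Data.List using ([]; _∷_)
open import Data.List.Relation.Unary.All using (All; []; _∷_)
open import Data.Product using (∃; ∃₂; _×_; _,_; proj₁; proj₂; uncurry)
open import Data.Sum using (_⊎_; inj₁; inj₂; [_,_]′)
open import Data.Empty using (⊥-elim)
open import Relation.Nullary using (¬_; Dec; yes; no; does; contradiction)
open import Relation.Nullary.Decidable using (dec-true; _×-dec_; _⊎-dec_; _→-dec_; ¬?; decidable-stable)
open import Relation.Binary.Definitions using (tri<; tri≈; tri>)
open import Relation.Binary.PropositionalEquality using (_≡_; _≢_; refl; sym; trans; cong; cong₂; subst)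
open import Algebra.Structures using (IsAbelianGroup)
open import Algebra.Bundles using (AbelianGroup; CommutativeMonoid)
import Algebra.Properties.AbelianGroup as AbelianGroupProperties
import Algebra.Properties.CommutativeSemigroup as CommutativeSemigroupProperties
open Relation.Binary.PropositionalEquality.≡-Reasoning

even : ℕ → Bool
even zero = true
even (suc k) = not (even k)

even⇒2∣ : ∀ k → even k ≡ true → 2 ∣ k
even⇒2∣ zero _ = divides 0 refl
even⇒2∣ (suc zero) ()
even⇒2∣ (suc (suc k)) e with even⇒2∣ k (trans (sym (not-involutive (even k))) e)
... | divides q eq = divides (suc q) (cong (λ m → suc (suc m)) eq)

2∣⇒even : ∀ k → 2 ∣ k → even k ≡ true
2∣⇒even k (divides q refl) = go q
  where
  go : ∀ q → even (q * 2) ≡ true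
  go zero = refl
  go (suc q) = trans (not-involutive (even (q * 2))) (go q)

¬2∣⇒even≡false : ∀ k → ¬ 2 ∣ k → even k ≡ false
¬2∣⇒even≡false k ¬2∣k with even k in eq
... | true = ⊥-elim (¬2∣k (even⇒2∣ k eq))
... | false = refl

even-+ʳ : ∀ a {b} → even b ≡ true → even (a + b) ≡ even a
even-+ʳ zero eb = eb
even-+ʳ (suc a) eb = cong not (even-+ʳ a eb)

x∈p─q⇒x∉q : ∀ {N} (p q : Subset N) {x} → x ∈ p ─ q → x ∉ q
x∈p─q⇒x∉q (_ ∷ p) (outside ∷ q) here ()
x∈p─q⇒x∉q (inside ∷ p) (inside ∷ q) () here
x∈p─q⇒x∉q (outside ∷ p) (inside ∷ q) () here
x∈p─q⇒x∉q (_ ∷ p) (_ ∷ q) (there x∈) (there x∈q) = x∈p─q⇒x∉q p q x∈ x∈q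

x∈p-y⇒x≢y : ∀ {N} (p : Subset N) {x y} → x ∈ p - y → x ≢ y
x∈p-y⇒x≢y p {y = y} x∈ refl = x∈p─q⇒x∉q p ⁅ y ⁆ x∈ (x∈⁅x⁆ y)

x∈p-y⇒x∈p : ∀ {N} (p : Subset N) {x y} → x ∈ p - y → x ∈ p
x∈p-y⇒x∈p p {y = y} = p─q⊆p p ⁅ y ⁆

∣p∣≡1+∣p-x∣ : ∀ {N} (p : Subset N) {x} → x ∈ p → ∣ p ∣ ≡ suc ∣ p - x ∣
∣p∣≡1+∣p-x∣ (inside ∷ p) here = cong (λ q → suc ∣ q ∣) (sym (p─⊥≡p p))
∣p∣≡1+∣p-x∣ (inside ∷ p) (there x∈) = cong suc (∣p∣≡1+∣p-x∣ p x∈)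
∣p∣≡1+∣p-x∣ (outside ∷ p) (there x∈) = ∣p∣≡1+∣p-x∣ p x∈

module _ {N : ℕ} where

  ∈∪⁅⁆ˡ : ∀ {p : Subset N} {x y} → x ∈ p → x ∈ p ∪ ⁅ y ⁆
  ∈∪⁅⁆ˡ x∈ = x∈p∪q⁺ (inj₁ x∈)

  ∈∪⁅⁆ʳ : ∀ {p : Subset N} {y} → y ∈ p ∪ ⁅ y ⁆
  ∈∪⁅⁆ʳ {y = y} = x∈p∪q⁺ (inj₂ (x∈⁅x⁆ y))

  ∈∪⁅⁆⁻ : ∀ {p : Subset N} {x y} → x ∈ p ∪ ⁅ y ⁆ → x ∈ p ⊎ x ≡ y
  ∈∪⁅⁆⁻ {p} {y = y} x∈ with x∈p∪q⁻ p ⁅ y ⁆ x∈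
  ... | inj₁ x∈p = inj₁ x∈p
  ... | inj₂ x∈y = inj₂ (x∈⁅y⁆⇒x≡y y x∈y)

  ∪⁅⁆-mono : ∀ {p q : Subset N} {y} → p ⊆ q → p ∪ ⁅ y ⁆ ⊆ q ∪ ⁅ y ⁆
  ∪⁅⁆-mono p⊆q x∈ with ∈∪⁅⁆⁻ x∈
  ... | inj₁ x∈p = ∈∪⁅⁆ˡ (p⊆q x∈p)
  ... | inj₂ refl = ∈∪⁅⁆ʳ

  ∪⁅⁆-swap : ∀ {p : Subset N} {y z} → (p ∪ ⁅ y ⁆) ∪ ⁅ z ⁆ ⊆ (p ∪ ⁅ z ⁆) ∪ ⁅ y ⁆
  ∪⁅⁆-swap x∈ with ∈∪⁅⁆⁻ x∈
  ... | inj₂ refl = ∈∪⁅⁆ˡ ∈∪⁅⁆ʳ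
  ... | inj₁ x∈′ with ∈∪⁅⁆⁻ x∈′
  ...   | inj₁ x∈p = ∈∪⁅⁆ˡ (∈∪⁅⁆ˡ x∈p)
  ...   | inj₂ refl = ∈∪⁅⁆ʳ

  ∪⁅⁆-absorb : ∀ {p : Subset N} {y} → y ∈ p → p ∪ ⁅ y ⁆ ⊆ p
  ∪⁅⁆-absorb y∈ x∈ with ∈∪⁅⁆⁻ x∈
  ... | inj₁ x∈p = x∈p
  ... | inj₂ refl = y∈

  ∣p∪⁅x⁆∣≡1+∣p∣ : ∀ {p : Subset N} {x} → x ∉ p → ∣ p ∪ ⁅ x ⁆ ∣ ≡ suc ∣ p ∣
  ∣p∪⁅x⁆∣≡1+∣p∣ {p} {x} x∉ =
    trans (∣p∣≡1+∣p-x∣ (p ∪ ⁅ x ⁆) ∈∪⁅⁆ʳ) (cong (λ q → suc ∣ q ∣) (⊆-antisym ⊆p ⊇p))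
    where
    ⊆p : (p ∪ ⁅ x ⁆) - x ⊆ p
    ⊆p y∈ with ∈∪⁅⁆⁻ (x∈p-y⇒x∈p (p ∪ ⁅ x ⁆) y∈)
    ... | inj₁ y∈p = y∈p
    ... | inj₂ y≡x = ⊥-elim (x∈p-y⇒x≢y (p ∪ ⁅ x ⁆) y∈ y≡x)
    ⊇p : p ⊆ (p ∪ ⁅ x ⁆) - x
    ⊇p y∈ = x∈p∧x≢y⇒x∈p-y (∈∪⁅⁆ˡ y∈) λ { refl → x∉ y∈ }

∣p∣≤1⇒⊆⁅x⁆ : ∀ {N} (p : Subset N) → ∣ p ∣ ≤ 1 → Fin N → ∃ λ x → p ⊆ ⁅ x ⁆
∣p∣≤1⇒⊆⁅x⁆ p ∣p∣≤1 default with nonempty? p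
... | no ∄x = default , λ y∈ → ⊥-elim (∄x (_ , y∈))
... | yes (x , x∈) = x , ⊆⁅x⁆
  where
  ⊆⁅x⁆ : p ⊆ ⁅ x ⁆
  ⊆⁅x⁆ {y} y∈ with y ≟ᶠ x
  ... | yes refl = x∈⁅x⁆ x
  ... | no y≢x = contradiction (subst (_≤ 1) ∣p∣≡2+∣p-x-y∣ ∣p∣≤1) λ { (s≤s ()) }
    where
    ∣p∣≡2+∣p-x-y∣ : ∣ p ∣ ≡ suc (suc ∣ p - x - y ∣)
    ∣p∣≡2+∣p-x-y∣ = trans (∣p∣≡1+∣p-x∣ p x∈) (cong suc (∣p∣≡1+∣p-x∣ (p - x) (x∈p∧x≢y⇒x∈p-y y∈ y≢x)))

∣p∣≤2⇒⊆⁅x⁆∪⁅y⁆ : ∀ {N} (p : Subset N) → ∣ p ∣ ≤ 2 → Fin N → ∃₂ λ x y → p ⊆ ⁅ x ⁆ ∪ ⁅ y ⁆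
∣p∣≤2⇒⊆⁅x⁆∪⁅y⁆ p ∣p∣≤2 default with nonempty? p
... | no ∄x = default , default , λ z∈ → ⊥-elim (∄x (_ , z∈))
... | yes (x , x∈) with ∣p∣≤1⇒⊆⁅x⁆ (p - x) (s≤s⁻¹ (subst (_≤ 2) (∣p∣≡1+∣p-x∣ p x∈) ∣p∣≤2)) default
... | y , p-x⊆⁅y⁆ = x , y , ⊆⁅x⁆∪⁅y⁆
  where
  ⊆⁅x⁆∪⁅y⁆ : p ⊆ ⁅ x ⁆ ∪ ⁅ y ⁆
  ⊆⁅x⁆∪⁅y⁆ {z} z∈ with z ≟ᶠ x
  ... | yes refl = x∈p∪q⁺ (inj₁ (x∈⁅x⁆ x))
  ... | no z≢x = x∈p∪q⁺ (inj₂ (p-x⊆⁅y⁆ (x∈p∧x≢y⇒x∈p-y z∈ z≢x)))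

∣⁅x⁆∪⁅y⁆∣≤2 : ∀ {N} (x y : Fin N) → ∣ ⁅ x ⁆ ∪ ⁅ y ⁆ ∣ ≤ 2
∣⁅x⁆∪⁅y⁆∣≤2 x y with y ≟ᶠ x
... | yes refl = ≤-trans (≤-reflexive (cong ∣_∣ (∪-idem ⁅ x ⁆))) (≤-trans (≤-reflexive (∣⁅x⁆∣≡1 x)) (s≤s z≤n))
... | no y≢x = ≤-reflexive (trans (∣p∪⁅x⁆∣≡1+∣p∣ λ y∈ → y≢x (x∈⁅y⁆⇒x≡y x y∈)) (cong suc (∣⁅x⁆∣≡1 x)))

module _ {N : ℕ} (σ : Fin N → Fin N) where

  Stable FixedPointFree : Subset N → Set
  Stable H = ∀ {x} → x ∈ H → σ x ∈ H
  FixedPointFree H = ∀ {x} → x ∈ H → σ x ≢ x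

module _ {N : ℕ} {σ : Fin N → Fin N} (σ-involutive : ∀ x → σ (σ x) ≡ x) where

  remove-orbit : ∀ {H x} → Stable σ H → FixedPointFree σ H → x ∈ H
               → ∃ λ H′ → ∣ H ∣ ≡ suc (suc ∣ H′ ∣) × Stable σ H′ × FixedPointFree σ H′
  remove-orbit {H} {x} stable free x∈ = H - x - σ x , ∣H∣≡2+∣H′∣ , stable′ , free′
    where
    σx∈H-x : σ x ∈ H - x
    σx∈H-x = x∈p∧x≢y⇒x∈p-y (stable x∈) (free x∈)
    ∣H∣≡2+∣H′∣ : ∣ H ∣ ≡ suc (suc ∣ H - x - σ x ∣)
    ∣H∣≡2+∣H′∣ = trans (∣p∣≡1+∣p-x∣ H x∈) (cong suc (∣p∣≡1+∣p-x∣ (H - x) σx∈H-x))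
    stable′ : Stable σ (H - x - σ x)
    stable′ {y} y∈ = x∈p∧x≢y⇒x∈p-y (x∈p∧x≢y⇒x∈p-y (stable y∈H) σy≢x) σy≢σx
      where
      y∈H-x = x∈p-y⇒x∈p (H - x) y∈
      y∈H = x∈p-y⇒x∈p H y∈H-x
      σy≢x : σ y ≢ x
      σy≢x σy≡x = x∈p-y⇒x≢y (H - x) y∈ (trans (sym (σ-involutive y)) (cong σ σy≡x))
      σy≢σx : σ y ≢ σ x
      σy≢σx σy≡σx = x∈p-y⇒x≢y H y∈H-x (trans (sym (σ-involutive y)) (trans (cong σ σy≡σx) (σ-involutive x)))
    free′ : FixedPointFree σ (H - x - σ x)
    free′ y∈ = free (x∈p-y⇒x∈p H (x∈p-y⇒x∈p (H - x) y∈))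

  fixedPointFree-involution⇒even : ∀ H → Stable σ H → FixedPointFree σ H → even ∣ H ∣ ≡ true
  fixedPointFree-involution⇒even H = go ∣ H ∣ H refl
    where
    go : ∀ k H → ∣ H ∣ ≡ k → Stable σ H → FixedPointFree σ H → even k ≡ true
    go zero _ _ _ _ = refl
    go (suc k) H ∣H∣≡1+k stable free with nonempty? H
    ... | no ∄x with trans (sym ∣H∣≡1+k) (trans (cong ∣_∣ (Empty-unique ∄x)) (∣⊥∣≡0 N))
    ...   | ()
    go (suc k) H ∣H∣≡1+k stable free | yes (x , x∈) with remove-orbit stable free x∈
    ... | H′ , ∣H∣≡2+∣H′∣ , stable′ , free′ with k | trans (sym ∣H∣≡1+k) ∣H∣≡2+∣H′∣
    ...   | suc k′ | ∣H∣≡2+k′ = trans (not-involutive (even k′))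
                                   (go k′ H′ (suc-injective (suc-injective (sym ∣H∣≡2+k′))) stable′ free′)

module _ {N : ℕ} {P : Fin N → Set} (P? : ∀ x → Dec (P x)) where

  fromDec : Subset N
  fromDec = tabulate (λ x → does (P? x))

  fromDec⁺ : ∀ {x} → P x → x ∈ fromDec
  fromDec⁺ {x} px = lookup⇒[]= x _ (trans (lookup∘tabulate _ x) (dec-true (P? x) px))

  fromDec⁻ : ∀ {x} → x ∈ fromDec → P x
  fromDec⁻ {x} x∈ with P? x | trans (sym (lookup∘tabulate _ x)) ([]=⇒lookup x∈)
  ... | yes px | _ = px

∪-mono-⊆ : ∀ {N} {p p′ q q′ : Subset N} → p ⊆ p′ → q ⊆ q′ → p ∪ q ⊆ p′ ∪ q′
∪-mono-⊆ {p = p} {q = q} p⊆p′ q⊆q′ x∈ with x∈p∪q⁻ p q x∈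
... | inj₁ x∈p = x∈p∪q⁺ (inj₁ (p⊆p′ x∈p))
... | inj₂ x∈q = x∈p∪q⁺ (inj₂ (q⊆q′ x∈q))

¬2∣⇒pty≡1 : ∀ k → ¬ 2 ∣ k → pty k ≡ 1
¬2∣⇒pty≡1 k ¬2∣k with k % 2 | m%n<n k 2 | m%n≡0⇒n∣m k 2
... | zero | _ | 2∣k = ⊥-elim (¬2∣k (2∣k refl))
... | suc zero | _ | _ = refl
... | suc (suc _) | s≤s (s≤s ()) | _

module Subgroups (G : GroupTable) where
  open GroupTable G

  isSubgroup? : ∀ H → Dec (IsSubgroup G H)
  isSubgroup? H = (e ∈? H)
    ×-dec all? (λ x → all? (λ y → (x ∈? H) →-dec ((y ∈? H) →-dec ((x · y) ∈? H))))
    ×-dec all? (λ x → (x ∈? H) →-dec (inv x ∈? H))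

  ∈⟨⟩? : ∀ x P → Dec (_∈⟨_⟩ G x P)
  ∈⟨⟩? x P with anySubset? (λ H → isSubgroup? H ×-dec (P ⊆? H) ×-dec ¬? (x ∈? H))
  ... | yes (H , H≤G , P⊆H , x∉H) = no λ x∈⟨P⟩ → x∉H (x∈⟨P⟩ H H≤G P⊆H)
  ... | no ∄H = yes λ H H≤G P⊆H → decidable-stable (x ∈? H) λ x∉H → ∄H (H , H≤G , P⊆H , x∉H)

  generates? : ∀ P → Dec (Generates G P)
  generates? P = all? (λ x → ∈⟨⟩? x P)

  ∈⇒∈⟨⟩ : ∀ {P x} → x ∈ P → _∈⟨_⟩ G x P
  ∈⇒∈⟨⟩ x∈P H _ P⊆H = P⊆H x∈P

  ∈⟨⟩-mono : ∀ {P Q x} → P ⊆ Q → _∈⟨_⟩ G x P → _∈⟨_⟩ G x Q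
  ∈⟨⟩-mono P⊆Q x∈⟨P⟩ H H≤G Q⊆H = x∈⟨P⟩ H H≤G (λ x∈P → Q⊆H (P⊆Q x∈P))

  generates-⊆⟨⟩ : ∀ {P Q} → (∀ {y} → y ∈ Q → _∈⟨_⟩ G y P) → Generates G Q → Generates G P
  generates-⊆⟨⟩ Q⊆⟨P⟩ genQ x H H≤G P⊆H = genQ x H H≤G (λ y∈Q → Q⊆⟨P⟩ y∈Q H H≤G P⊆H)

  generates-mono : ∀ {P Q} → P ⊆ Q → Generates G P → Generates G Q
  generates-mono P⊆Q = generates-⊆⟨⟩ (λ y∈P → ∈⇒∈⟨⟩ (P⊆Q y∈P))

  Closed : Subset N → Set
  Closed P = ∀ x → _∈⟨_⟩ G x P → x ∈ P

  closed⇒subgroup : ∀ {P} → Closed P → IsSubgroup G P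
  closed⇒subgroup closed =
      closed e (λ H H≤G _ → proj₁ H≤G)
    , (λ x y x∈ y∈ → closed (x · y) λ H H≤G P⊆H → proj₁ (proj₂ H≤G) x y (P⊆H x∈) (P⊆H y∈))
    , (λ x x∈ → closed (inv x) λ H H≤G P⊆H → proj₂ (proj₂ H≤G) x (P⊆H x∈))

  subgroup⇒closed : ∀ {P} → IsSubgroup G P → Closed P
  subgroup⇒closed P≤G x x∈⟨P⟩ = x∈⟨P⟩ _ P≤G (λ y∈ → y∈)

  closed-or-extendable : ∀ P → Closed P ⊎ (∃ λ g → g ∉ P × _∈⟨_⟩ G g P)
  closed-or-extendable P with any? (λ g → ¬? (g ∈? P) ×-dec ∈⟨⟩? g P)
  ... | yes g,g∉P,g∈⟨P⟩ = inj₂ g,g∉P,g∈⟨P⟩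
  ... | no ∄g = inj₁ λ x x∈⟨P⟩ → decidable-stable (x ∈? P) λ x∉P → ∄g (x , x∉P , x∈⟨P⟩)

  ∩-subgroup : ∀ {H K} → IsSubgroup G H → IsSubgroup G K → IsSubgroup G (H ∩ K)
  ∩-subgroup (eH , mulH , invH) (eK , mulK , invK) =
      x∈p∩q⁺ (eH , eK)
    , (λ x y x∈ y∈ → let (x∈H , x∈K) = x∈p∩q⁻ _ _ x∈ ; (y∈H , y∈K) = x∈p∩q⁻ _ _ y∈ in
         x∈p∩q⁺ (mulH x y x∈H y∈H , mulK x y x∈K y∈K))
    , (λ x x∈ → let (x∈H , x∈K) = x∈p∩q⁻ _ _ x∈ in x∈p∩q⁺ (invH x x∈H , invK x x∈K))

  ⋂-maximal-subgroup : ∀ Ms → All (IsMaximal G) Ms → IsSubgroup G (⋂ Ms)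
  ⋂-maximal-subgroup [] [] = ∈⊤ , (λ _ _ _ _ → ∈⊤) , (λ _ _ → ∈⊤)
  ⋂-maximal-subgroup (M ∷ Ms) (M-max ∷ Ms-max) = ∩-subgroup (proj₁ M-max) (⋂-maximal-subgroup Ms Ms-max)

  Proper : Subset N → Set
  Proper H = ∃ λ x → x ∉ H

  proper? : ∀ H → Dec (Proper H)
  proper? H = any? (λ x → ¬? (x ∈? H))

  ¬proper⇒≡⊤ : ∀ {H} → ¬ Proper H → H ≡ ⊤
  ¬proper⇒≡⊤ {H} ¬proper = ⊆-antisym ⊆⊤ λ {x} _ → decidable-stable (x ∈? H) λ x∉H → ¬proper (x , x∉H)

  maximal-if-no-proper-above : ∀ H → IsSubgroup G H → Proper H
    → ¬ (∃ λ K → IsSubgroup G K × H ⊂ K × Proper K) → IsMaximal G H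
  maximal-if-no-proper-above H H≤G (x , x∉H) ∄K = H≤G , (⊆⊤ , x , ∈⊤ , x∉H) , maximality
    where
    maximality : ∀ K → IsSubgroup G K → H ⊆ K → K ≡ H ⊎ K ≡ ⊤
    maximality K K≤G H⊆K with ≡-dec _≟ᵇ_ K H
    ... | yes K≡H = inj₁ K≡H
    ... | no K≢H with any? (λ y → (y ∈? K) ×-dec ¬? (y ∈? H))
    ...   | no ∄y = ⊥-elim (K≢H (⊆-antisym K⊆H H⊆K))
      where
      K⊆H : K ⊆ H
      K⊆H {y} y∈K = decidable-stable (y ∈? H) λ y∉H → ∄y (y , y∈K , y∉H)
    ...   | yes (y , y∈K , y∉H) with proper? K
    ...     | yes K-proper = ⊥-elim (∄K (K , K≤G , (H⊆K , y , y∈K , y∉H) , K-proper))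
    ...     | no ¬K-proper = inj₂ (¬proper⇒≡⊤ ¬K-proper)

  proper-subgroup⊆maximal : ∀ H → IsSubgroup G H → Proper H → ∃ λ M → IsMaximal G M × H ⊆ M
  proper-subgroup⊆maximal H = <-rec Goal step (N ∸ ∣ H ∣) H refl
    where
    Goal : ℕ → Set
    Goal k = ∀ H → N ∸ ∣ H ∣ ≡ k → IsSubgroup G H → Proper H → ∃ λ M → IsMaximal G M × H ⊆ M
    step : ∀ k → (∀ {j} → j < k → Goal j) → Goal k
    step k rec H refl H≤G H-proper with anySubset? (λ K → isSubgroup? K ×-dec (H ⊂? K) ×-dec proper? K)
    ... | no ∄K = H , maximal-if-no-proper-above H H≤G H-proper ∄K , (λ x∈ → x∈)
    ... | yes (K , K≤G , H⊂K , K-proper) with rec (∸-monoʳ-< (p⊂q⇒∣p∣<∣q∣ H⊂K) (∣p∣≤n K)) K refl K≤G K-proper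
    ...   | M , M-max , K⊆M = M , M-max , (λ x∈ → K⊆M (proj₁ H⊂K x∈))

  non-generating⊆maximal : ∀ S → ¬ Generates G S → ∃ λ M → IsMaximal G M × S ⊆ M
  non-generating⊆maximal S ¬gen with anySubset? (λ H → isSubgroup? H ×-dec (S ⊆? H) ×-dec proper? H)
  ... | no ∄H = ⊥-elim (¬gen λ x H H≤G S⊆H → decidable-stable (x ∈? H) λ x∉H → ∄H (H , H≤G , S⊆H , x , x∉H))
  ... | yes (H , H≤G , S⊆H , H-proper) with proper-subgroup⊆maximal H H≤G H-proper
  ...   | M , M-max , H⊆M = M , M-max , (λ x∈ → H⊆M (S⊆H x∈))

  δ≤1 δ≤2 : Subset N → Set
  δ≤1 P = ∃ λ g → Generates G (P ∪ ⁅ g ⁆)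
  δ≤2 P = ∃₂ λ g h → Generates G ((P ∪ ⁅ g ⁆) ∪ ⁅ h ⁆)

  δ≤1? : ∀ P → Dec (δ≤1 P)
  δ≤1? P = any? λ g → generates? (P ∪ ⁅ g ⁆)

  δ≤2? : ∀ P → Dec (δ≤2 P)
  δ≤2? P = any? λ g → any? λ h → generates? ((P ∪ ⁅ g ⁆) ∪ ⁅ h ⁆)

  δ≤1-mono : ∀ {P Q} → P ⊆ Q → δ≤1 P → δ≤1 Q
  δ≤1-mono P⊆Q (g , gen) = g , generates-mono (∪⁅⁆-mono P⊆Q) gen

  δ≤2-mono : ∀ {P Q} → P ⊆ Q → δ≤2 P → δ≤2 Q
  δ≤2-mono P⊆Q (g , h , gen) = g , h , generates-mono (∪⁅⁆-mono (∪⁅⁆-mono P⊆Q)) gen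

  δ≤1⇒δ≤2 : ∀ {P} → δ≤1 P → δ≤2 P
  δ≤1⇒δ≤2 (g , gen) = g , g , generates-mono ∈∪⁅⁆ˡ gen

  δ≤1-∪⁅⁆⇒δ≤2 : ∀ {P g} → δ≤1 (P ∪ ⁅ g ⁆) → δ≤2 P
  δ≤1-∪⁅⁆⇒δ≤2 {g = g} (h , gen) = g , h , gen

  module _ {P R g} (g∈⟨P⟩ : _∈⟨_⟩ G g P) (P⊆R : P ⊆ R) where

    generates-∪⟨⟩ : ∀ {Q} → Q ⊆ R ∪ ⁅ g ⁆ → Generates G Q → Generates G R
    generates-∪⟨⟩ Q⊆R∪g = generates-⊆⟨⟩ λ y∈Q → [ ∈⇒∈⟨⟩ , (λ { refl → ∈⟨⟩-mono P⊆R g∈⟨P⟩ }) ]′ (∈∪⁅⁆⁻ (Q⊆R∪g y∈Q))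

  module _ {P g} (g∈⟨P⟩ : _∈⟨_⟩ G g P) where

    generates-∪⟨⟩⁻ : Generates G (P ∪ ⁅ g ⁆) → Generates G P
    generates-∪⟨⟩⁻ = generates-∪⟨⟩ g∈⟨P⟩ (λ x∈ → x∈) (λ x∈ → x∈)

    δ≤1-∪⟨⟩⁻ : δ≤1 (P ∪ ⁅ g ⁆) → δ≤1 P
    δ≤1-∪⟨⟩⁻ (h , gen) = h , generates-∪⟨⟩ g∈⟨P⟩ ∈∪⁅⁆ˡ ∪⁅⁆-swap gen

    δ≤2-∪⟨⟩⁻ : δ≤2 (P ∪ ⁅ g ⁆) → δ≤2 P
    δ≤2-∪⟨⟩⁻ (h , k , gen) = h , k , generates-∪⟨⟩ g∈⟨P⟩ (λ x∈ → ∈∪⁅⁆ˡ (∈∪⁅⁆ˡ x∈))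
                                       (λ x∈ → ∪⁅⁆-swap (∪⁅⁆-mono ∪⁅⁆-swap x∈)) gen

  generates-∪-within-structure-class : ∀ {I P Q} → InI G I → P ⊆ I → (∀ J → InI G J → J ⊂ I → ¬ P ⊆ J)
                                     → Generates G (I ∪ Q) → Generates G (P ∪ Q)
  generates-∪-within-structure-class {I} {P} {Q} (Ms , _ , Ms-max , I≡⋂Ms) P⊆I minimal gen
    with generates? (P ∪ Q)
  ... | yes gen′ = gen′
  ... | no ¬gen′ with non-generating⊆maximal (P ∪ Q) ¬gen′
  ...   | M , M-max@(M≤G , (_ , x , _ , x∉M) , _) , P∪Q⊆M = ⊥-elim (minimal (M ∩ I) M∩I∈𝓘 M∩I⊂I P⊆M∩I)
    where
    M∩I∈𝓘 : InI G (M ∩ I)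
    M∩I∈𝓘 = M ∷ Ms , (λ ()) , M-max ∷ Ms-max , cong (M ∩_) I≡⋂Ms
    P⊆M∩I : P ⊆ M ∩ I
    P⊆M∩I x∈ = x∈p∩q⁺ (P∪Q⊆M (x∈p∪q⁺ (inj₁ x∈)) , P⊆I x∈)
    M∩I⊂I : M ∩ I ⊂ I
    M∩I⊂I with any? (λ x → (x ∈? I) ×-dec ¬? (x ∈? M))
    ... | yes (x , x∈I , x∉M) = p∩q⊆q M I , x , x∈I , (λ x∈M∩I → x∉M (proj₁ (x∈p∩q⁻ M I x∈M∩I)))
    ... | no ∄y = ⊥-elim (x∉M (gen x M M≤G I∪Q⊆M))
      where
      I∪Q⊆M : I ∪ Q ⊆ M
      I∪Q⊆M {y} y∈ = [ (λ y∈I → decidable-stable (y ∈? M) λ y∉M → ∄y (y , y∈I , y∉M))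
                     , (λ y∈Q → P∪Q⊆M (x∈p∪q⁺ (inj₂ y∈Q))) ]′ (x∈p∪q⁻ I Q y∈)

  module _ {S P : Subset N} (P⊆S : P ⊆ S) where

    deficiency≥2⇒¬δ≤1 : ∀ {m} → Deficiency G S m → 2 ≤ m → ¬ δ≤1 P
    deficiency≥2⇒¬δ≤1 (_ , minimal) 2≤m (g , gen) with
      ≤-trans 2≤m (≤-trans (minimal ⁅ g ⁆ (generates-mono (∪⁅⁆-mono P⊆S) gen)) (≤-reflexive (∣⁅x⁆∣≡1 g)))
    ... | s≤s ()

    deficiency-3⇒¬δ≤2 : Deficiency G S 3 → ¬ δ≤2 P
    deficiency-3⇒¬δ≤2 (_ , minimal) (g , h , gen) with
      ≤-trans (minimal (⁅ g ⁆ ∪ ⁅ h ⁆) (generates-mono P∪g∪h⊆S∪⁅g⁆∪⁅h⁆ gen)) (∣⁅x⁆∪⁅y⁆∣≤2 g h)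
      where
      P∪g∪h⊆S∪⁅g⁆∪⁅h⁆ : (P ∪ ⁅ g ⁆) ∪ ⁅ h ⁆ ⊆ S ∪ (⁅ g ⁆ ∪ ⁅ h ⁆)
      P∪g∪h⊆S∪⁅g⁆∪⁅h⁆ x∈ = subst (_ ∈_) (∪-assoc S ⁅ g ⁆ ⁅ h ⁆) (∪⁅⁆-mono (∪⁅⁆-mono P⊆S) x∈)
    ... | s≤s (s≤s ())

  module _ {S P : Subset N} (transfer : ∀ Q → Generates G (S ∪ Q) → Generates G (P ∪ Q)) where

    deficiency-1⇒δ≤1 : Deficiency G S 1 → δ≤1 P
    deficiency-1⇒δ≤1 ((Q , ∣Q∣≡1 , gen) , _) with ∣p∣≤1⇒⊆⁅x⁆ Q (≤-reflexive ∣Q∣≡1) e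
    ... | a , Q⊆⁅a⁆ = a , generates-mono (∪-mono-⊆ (λ x∈ → x∈) Q⊆⁅a⁆) (transfer Q gen)

    deficiency-2⇒δ≤2 : Deficiency G S 2 → δ≤2 P
    deficiency-2⇒δ≤2 ((Q , ∣Q∣≡2 , gen) , _) with ∣p∣≤2⇒⊆⁅x⁆∪⁅y⁆ Q (≤-reflexive ∣Q∣≡2) e
    ... | a , b , Q⊆⁅a⁆∪⁅b⁆ = a , b , generates-mono P∪Q⊆P∪a∪b (transfer Q gen)
      where
      P∪Q⊆P∪a∪b : P ∪ Q ⊆ (P ∪ ⁅ a ⁆) ∪ ⁅ b ⁆
      P∪Q⊆P∪a∪b x∈ = subst (_ ∈_) (sym (∪-assoc P ⁅ a ⁆ ⁅ b ⁆)) (∪-mono-⊆ (λ y∈ → y∈) Q⊆⁅a⁆∪⁅b⁆ x∈)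

  minGens-2⇒generating-pair : MinGens G 2 → ∃₂ λ a b → Generates G (⁅ a ⁆ ∪ ⁅ b ⁆)
  minGens-2⇒generating-pair ((S , ∣S∣≡2 , gen) , _) with ∣p∣≤2⇒⊆⁅x⁆∪⁅y⁆ S (≤-reflexive ∣S∣≡2) e
  ... | a , b , S⊆⁅a⁆∪⁅b⁆ = a , b , generates-mono S⊆⁅a⁆∪⁅b⁆ gen

module OddOrder {n : ℕ} {_∘_ : Fin n → Fin n → Fin n} {eA : Fin n} {invA : Fin n → Fin n}
                (isAbelianGroup : IsAbelianGroup _≡_ _∘_ eA invA) (n-odd : ¬ 2 ∣ n) where

  private
    A : AbelianGroup _ _
    A = record { isAbelianGroup = isAbelianGroup }
  open IsAbelianGroup isAbelianGroup using (assoc; identityʳ; inverseʳ)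
  open AbelianGroupProperties A using (⁻¹-involutive; ⁻¹-∙-comm; ε⁻¹≈ε; identityʳ-unique)
  open CommutativeSemigroupProperties (CommutativeMonoid.commutativeSemigroup (AbelianGroup.commutativeMonoid A))
    using (interchange)

  square≡e? : ∀ x → Dec (x ∘ x ≡ eA)
  square≡e? x = (x ∘ x) ≟ᶠ eA

  SquareRootsOfE : Subset n
  SquareRootsOfE = fromDec square≡e?

  -- Inversion pairs off the elements outside SquareRootsOfE, so ∣ SquareRootsOfE ∣ is odd like n.
  ∣SquareRootsOfE∣-odd : even ∣ SquareRootsOfE ∣ ≡ false
  ∣SquareRootsOfE∣-odd = begin
    even ∣ SquareRootsOfE ∣                           ≡⟨ even-+ʳ ∣ SquareRootsOfE ∣ ∣∁SquareRootsOfE∣-even ⟨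
    even (∣ SquareRootsOfE ∣ + ∣ ∁ SquareRootsOfE ∣)  ≡⟨ cong even n≡∣R∣+∣∁R∣ ⟨
    even n                                            ≡⟨ ¬2∣⇒even≡false n n-odd ⟩
    false                                             ∎
    where
    square-of-inverse : ∀ x → invA x ∘ invA x ≡ eA → x ∘ x ≡ eA
    square-of-inverse x x⁻¹x⁻¹≡e = begin
      x ∘ x                     ≡⟨ ⁻¹-involutive (x ∘ x) ⟨
      invA (invA (x ∘ x))       ≡⟨ cong invA (⁻¹-∙-comm x x) ⟨
      invA (invA x ∘ invA x)    ≡⟨ cong invA x⁻¹x⁻¹≡e ⟩
      invA eA                   ≡⟨ ε⁻¹≈ε ⟩
      eA                        ∎
    ∁SquareRootsOfE-stable : Stable invA (∁ SquareRootsOfE)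
    ∁SquareRootsOfE-stable {x} x∈ = x∉p⇒x∈∁p λ x⁻¹∈ →
      x∈∁p⇒x∉p x∈ (fromDec⁺ square≡e? (square-of-inverse x (fromDec⁻ square≡e? x⁻¹∈)))
    ∁SquareRootsOfE-free : FixedPointFree invA (∁ SquareRootsOfE)
    ∁SquareRootsOfE-free {x} x∈ x⁻¹≡x =
      x∈∁p⇒x∉p x∈ (fromDec⁺ square≡e? (trans (cong (x ∘_) (sym x⁻¹≡x)) (inverseʳ x)))
    ∣∁SquareRootsOfE∣-even : even ∣ ∁ SquareRootsOfE ∣ ≡ true
    ∣∁SquareRootsOfE∣-even = fixedPointFree-involution⇒even ⁻¹-involutive (∁ SquareRootsOfE)
                               ∁SquareRootsOfE-stable ∁SquareRootsOfE-free
    n≡∣R∣+∣∁R∣ : n ≡ ∣ SquareRootsOfE ∣ + ∣ ∁ SquareRootsOfE ∣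
    n≡∣R∣+∣∁R∣ = trans (sym (m+[n∸m]≡n (∣p∣≤n SquareRootsOfE)))
                       (cong (∣ SquareRootsOfE ∣ +_) (sym (∣∁p∣≡n∸∣p∣ SquareRootsOfE)))

  -- Multiplication by a square root a ≢ e of e would pair off the elements of SquareRootsOfE.
  square≡e⇒≡e : ∀ {a} → a ∘ a ≡ eA → a ≡ eA
  square≡e⇒≡e {a} aa≡e with a ≟ᶠ eA
  ... | yes a≡e = a≡e
  ... | no a≢e = contradiction (trans (sym ∣SquareRootsOfE∣-even) ∣SquareRootsOfE∣-odd) λ ()
    where
    ·a-involutive : ∀ x → (x ∘ a) ∘ a ≡ x
    ·a-involutive x = trans (assoc x a a) (trans (cong (x ∘_) aa≡e) (identityʳ x))
    ·a-stable : Stable (_∘ a) SquareRootsOfE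
    ·a-stable {x} x∈ = fromDec⁺ square≡e?
      (trans (interchange x a x a) (trans (cong₂ _∘_ (fromDec⁻ square≡e? x∈) aa≡e) (identityʳ eA)))
    ·a-free : FixedPointFree (_∘ a) SquareRootsOfE
    ·a-free _ xa≡x = a≢e (identityʳ-unique _ a xa≡x)
    ∣SquareRootsOfE∣-even : even ∣ SquareRootsOfE ∣ ≡ true
    ∣SquareRootsOfE∣-even = fixedPointFree-involution⇒even ·a-involutive SquareRootsOfE ·a-stable ·a-free

module DihedralGroup {n : ℕ} {_∘_ : Fin n → Fin n → Fin n} {eA : Fin n} {invA : Fin n → Fin n}
                     (isAbelianGroup : IsAbelianGroup _≡_ _∘_ eA invA) where

  open GroupTable (Dih _∘_ eA invA)
  open Subgroups (Dih _∘_ eA invA) public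
  private
    A : AbelianGroup _ _
    A = record { isAbelianGroup = isAbelianGroup }
  open IsAbelianGroup isAbelianGroup using (assoc; identityˡ; identityʳ; inverseʳ)
  open AbelianGroupProperties A
    using (//-rightDividesˡ; //-rightDividesʳ; ⁻¹-involutive; ⁻¹-∙-comm; ε⁻¹≈ε; identityˡ-unique)
  open CommutativeSemigroupProperties (CommutativeMonoid.commutativeSemigroup (AbelianGroup.commutativeMonoid A))
    using (interchange; xy∙z≈xz∙y)

  GeneratesA : Subset n → Set
  GeneratesA = Generates (table _∘_ eA invA)

  Generatesᴰ : Subset N → Set
  Generatesᴰ = Generates (Dih _∘_ eA invA)

  ι ρ : Fin n → Fin N
  ι = combine {2} zero
  ρ = combine {2} (suc zero)

  ι·ι : ∀ a b → ι a · ι b ≡ ι (a ∘ b)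
  ι·ι a b rewrite splitAt-↑ˡ n a (n + 0) | splitAt-↑ˡ n b (n + 0) = refl
  ι·ρ : ∀ a b → ι a · ρ b ≡ ρ (a ∘ b)
  ι·ρ a b rewrite splitAt-↑ˡ n a (n + 0) | splitAt-↑ʳ n (n + 0) (b ↑ˡ 0) | splitAt-↑ˡ n b 0 = refl
  ρ·ι : ∀ a b → ρ a · ι b ≡ ρ (a ∘ invA b)
  ρ·ι a b rewrite splitAt-↑ʳ n (n + 0) (a ↑ˡ 0) | splitAt-↑ˡ n a 0 | splitAt-↑ˡ n b (n + 0) = refl
  ρ·ρ : ∀ a b → ρ a · ρ b ≡ ι (a ∘ invA b)
  ρ·ρ a b rewrite splitAt-↑ʳ n (n + 0) (a ↑ˡ 0) | splitAt-↑ˡ n a 0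
                | splitAt-↑ʳ n (n + 0) (b ↑ˡ 0) | splitAt-↑ˡ n b 0 = refl
  inv-ι : ∀ a → inv (ι a) ≡ ι (invA a)
  inv-ι a rewrite splitAt-↑ˡ n a (n + 0) = refl
  inv-ρ : ∀ a → inv (ρ a) ≡ ρ (invA (invA a))
  inv-ρ a rewrite splitAt-↑ʳ n (n + 0) (a ↑ˡ 0) | splitAt-↑ˡ n a 0 = refl

  data View : Fin N → Set where
    rot : ∀ a → View (ι a)
    ref : ∀ a → View (ρ a)

  view : ∀ u → View u
  view u = subst View (combine-remQuot {2} n u) (view′ (remQuot {2} n u))
    where
    view′ : ∀ p → View (uncurry combine p)
    view′ (zero , a) = rot a
    view′ (suc zero , a) = ref a

  ι-injective : ∀ {a b} → ι a ≡ ι b → a ≡ b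
  ι-injective {a} {b} ιa≡ιb = proj₂ (combine-injective {2} {n} zero a zero b ιa≡ιb)

  ρ-injective : ∀ {a b} → ρ a ≡ ρ b → a ≡ b
  ρ-injective {a} {b} ρa≡ρb = proj₂ (combine-injective {2} {n} (suc zero) a (suc zero) b ρa≡ρb)

  ι≢ρ : ∀ {a b} → ι a ≢ ρ b
  ι≢ρ {a} {b} ιa≡ρb with proj₁ (combine-injective {2} {n} zero a (suc zero) b ιa≡ρb)
  ... | ()

  rotation? : ∀ u → Dec (∃ λ a → u ≡ ι a)
  rotation? u = any? (λ a → u ≟ᶠ ι a)

  Rotations : Subset N
  Rotations = fromDec rotation?

  ι∈Rotations : ∀ a → ι a ∈ Rotations
  ι∈Rotations a = fromDec⁺ rotation? (a , refl)

  ρ∉Rotations : ∀ a → ρ a ∉ Rotations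
  ρ∉Rotations a ρa∈ with fromDec⁻ rotation? ρa∈
  ... | b , ρa≡ιb = ι≢ρ (sym ρa≡ιb)

  Rotations-subgroup : IsSubgroup (Dih _∘_ eA invA) Rotations
  Rotations-subgroup = ι∈Rotations eA , ·-closed , inv-closed
    where
    ·-closed : ∀ x y → x ∈ Rotations → y ∈ Rotations → (x · y) ∈ Rotations
    ·-closed x y x∈ y∈ with fromDec⁻ rotation? x∈ | fromDec⁻ rotation? y∈
    ... | a , refl | b , refl = subst (_∈ Rotations) (sym (ι·ι a b)) (ι∈Rotations (a ∘ b))
    inv-closed : ∀ x → x ∈ Rotations → inv x ∈ Rotations
    inv-closed x x∈ with fromDec⁻ rotation? x∈
    ... | a , refl = subst (_∈ Rotations) (sym (inv-ι a)) (ι∈Rotations (invA a))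

  HasReflection : Subset N → Set
  HasReflection P = ∃ λ a → ρ a ∈ P

  hasReflection? : ∀ P → Dec (HasReflection P)
  hasReflection? P = any? (λ a → ρ a ∈? P)

  ¬reflection⇒⊆Rotations : ∀ {P} → ¬ HasReflection P → P ⊆ Rotations
  ¬reflection⇒⊆Rotations {P} ¬refl {u} u∈ with view u
  ... | rot a = ι∈Rotations a
  ... | ref a = ⊥-elim (¬refl (a , u∈))

  ¬reflection⇒¬generates : ∀ {P} → ¬ HasReflection P → ¬ Generatesᴰ P
  ¬reflection⇒¬generates ¬refl gen =
    ρ∉Rotations eA (gen (ρ eA) Rotations Rotations-subgroup (¬reflection⇒⊆Rotations ¬refl))

  ι∈? : ∀ K a → Dec (ι a ∈ K)
  ι∈? K a = ι a ∈? K

  ι-preimage : Subset N → Subset n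
  ι-preimage K = fromDec (ι∈? K)

  ι-preimage-subgroup : ∀ {K} → IsSubgroup (Dih _∘_ eA invA) K → IsSubgroup (table _∘_ eA invA) (ι-preimage K)
  ι-preimage-subgroup {K} (e∈K , ·-closed , inv-closed) =
      fromDec⁺ (ι∈? K) e∈K
    , (λ a b a∈ b∈ → fromDec⁺ (ι∈? K)
         (subst (_∈ K) (ι·ι a b) (·-closed _ _ (fromDec⁻ (ι∈? K) a∈) (fromDec⁻ (ι∈? K) b∈))))
    , (λ a a∈ → fromDec⁺ (ι∈? K) (subst (_∈ K) (inv-ι a) (inv-closed _ (fromDec⁻ (ι∈? K) a∈))))

  -- For ρ c ∈ P, ⟨P⟩ is all of Dih(A) iff rotationParts P c generates A, because ρ (a ∘ c) · ρ c = ι a.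
  rotationPart? : ∀ P c a → Dec (ι a ∈ P ⊎ ρ (a ∘ c) ∈ P)
  rotationPart? P c a = (ι a ∈? P) ⊎-dec (ρ (a ∘ c) ∈? P)

  rotationParts : Subset N → Fin n → Subset n
  rotationParts P c = fromDec (rotationPart? P c)

  generated-by-rotationParts : ∀ {P S c} → ρ c ∈ P → GeneratesA S → S ⊆ rotationParts P c → Generatesᴰ P
  generated-by-rotationParts {P} {S} {c} ρc∈P genS S⊆ x K K≤G P⊆K = everything x
    where
    ·-closed = proj₁ (proj₂ K≤G)
    S⊆ι⁻¹K : S ⊆ ι-preimage K
    S⊆ι⁻¹K {a} a∈ with fromDec⁻ (rotationPart? P c) (S⊆ a∈)
    ... | inj₁ ιa∈P = fromDec⁺ (ι∈? K) (P⊆K ιa∈P)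
    ... | inj₂ ρac∈P = fromDec⁺ (ι∈? K) (subst (_∈ K) (trans (ρ·ρ (a ∘ c) c) (cong ι (//-rightDividesʳ c a)))
                                                (·-closed _ _ (P⊆K ρac∈P) (P⊆K ρc∈P)))
    ι∈K : ∀ a → ι a ∈ K
    ι∈K a = fromDec⁻ (ι∈? K) (genS a (ι-preimage K) (ι-preimage-subgroup K≤G) S⊆ι⁻¹K)
    everything : ∀ x → x ∈ K
    everything x with view x
    ... | rot a = ι∈K a
    ... | ref a = subst (_∈ K) (trans (ι·ρ (a ∘ invA c) c) (cong ρ (//-rightDividesˡ c a)))
                                (·-closed _ _ (ι∈K (a ∘ invA c)) (P⊆K ρc∈P))

  extension? : ∀ B c u → Dec ((∃ λ a → u ≡ ι a × a ∈ B) ⊎ (∃ λ a → u ≡ ρ a × (a ∘ invA c) ∈ B))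
  extension? B c u = any? (λ a → (u ≟ᶠ ι a) ×-dec (a ∈? B)) ⊎-dec any? (λ a → (u ≟ᶠ ρ a) ×-dec ((a ∘ invA c) ∈? B))

  _⋊⟨ρ_⟩ : Subset n → Fin n → Subset N
  B ⋊⟨ρ c ⟩ = fromDec (extension? B c)

  module _ {B : Subset n} {c : Fin n} where

    ι∈⋊⁺ : ∀ {a} → a ∈ B → ι a ∈ B ⋊⟨ρ c ⟩
    ι∈⋊⁺ a∈ = fromDec⁺ (extension? B c) (inj₁ (_ , refl , a∈))

    ρ∈⋊⁺ : ∀ {a} → (a ∘ invA c) ∈ B → ρ a ∈ B ⋊⟨ρ c ⟩
    ρ∈⋊⁺ a∈ = fromDec⁺ (extension? B c) (inj₂ (_ , refl , a∈))

    ι∈⋊⁻ : ∀ {a} → ι a ∈ B ⋊⟨ρ c ⟩ → a ∈ B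
    ι∈⋊⁻ ιa∈ with fromDec⁻ (extension? B c) ιa∈
    ... | inj₁ (b , ιa≡ιb , b∈) = subst (_∈ B) (sym (ι-injective ιa≡ιb)) b∈
    ... | inj₂ (b , ιa≡ρb , _) = ⊥-elim (ι≢ρ ιa≡ρb)

    ρ∈⋊⁻ : ∀ {a} → ρ a ∈ B ⋊⟨ρ c ⟩ → (a ∘ invA c) ∈ B
    ρ∈⋊⁻ ρa∈ with fromDec⁻ (extension? B c) ρa∈
    ... | inj₁ (b , ρa≡ιb , _) = ⊥-elim (ι≢ρ (sym ρa≡ιb))
    ... | inj₂ (b , ρa≡ρb , b∈) = subst (λ a → (a ∘ invA c) ∈ B) (sym (ρ-injective ρa≡ρb)) b∈

    ⋊-subgroup : IsSubgroup (table _∘_ eA invA) B → IsSubgroup (Dih _∘_ eA invA) (B ⋊⟨ρ c ⟩)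
    ⋊-subgroup (eB , ·B , invB) = ι∈⋊⁺ eB , ·-closed , inv-closed
      where
      ρ-parts : ∀ a b → (a ∘ invA c) ∘ invA (b ∘ invA c) ≡ a ∘ invA b
      ρ-parts a b = begin
        (a ∘ invA c) ∘ invA (b ∘ invA c)         ≡⟨ cong ((a ∘ invA c) ∘_) (sym (⁻¹-∙-comm b (invA c))) ⟩
        (a ∘ invA c) ∘ (invA b ∘ invA (invA c))  ≡⟨ interchange a (invA c) (invA b) (invA (invA c)) ⟩
        (a ∘ invA b) ∘ (invA c ∘ invA (invA c))  ≡⟨ cong ((a ∘ invA b) ∘_) (inverseʳ (invA c)) ⟩
        (a ∘ invA b) ∘ eA                        ≡⟨ identityʳ (a ∘ invA b) ⟩
        a ∘ invA b                               ∎
      ·-closed : ∀ x y → x ∈ B ⋊⟨ρ c ⟩ → y ∈ B ⋊⟨ρ c ⟩ → (x · y) ∈ B ⋊⟨ρ c ⟩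
      ·-closed x y x∈ y∈ with view x | view y
      ... | rot a | rot b = subst (_∈ _) (sym (ι·ι a b)) (ι∈⋊⁺ (·B _ _ (ι∈⋊⁻ x∈) (ι∈⋊⁻ y∈)))
      ... | rot a | ref b = subst (_∈ _) (sym (ι·ρ a b)) (ρ∈⋊⁺ (subst (_∈ B) (sym (assoc a b (invA c)))
                                (·B _ _ (ι∈⋊⁻ x∈) (ρ∈⋊⁻ y∈))))
      ... | ref a | rot b = subst (_∈ _) (sym (ρ·ι a b)) (ρ∈⋊⁺ (subst (_∈ B) (xy∙z≈xz∙y a (invA c) (invA b))
                                (·B _ _ (ρ∈⋊⁻ x∈) (invB _ (ι∈⋊⁻ y∈)))))
      ... | ref a | ref b = subst (_∈ _) (sym (ρ·ρ a b)) (ι∈⋊⁺ (subst (_∈ B) (ρ-parts a b)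
                                (·B _ _ (ρ∈⋊⁻ x∈) (invB _ (ρ∈⋊⁻ y∈)))))
      inv-closed : ∀ x → x ∈ B ⋊⟨ρ c ⟩ → inv x ∈ B ⋊⟨ρ c ⟩
      inv-closed x x∈ with view x
      ... | rot a = subst (_∈ _) (sym (inv-ι a)) (ι∈⋊⁺ (invB _ (ι∈⋊⁻ x∈)))
      ... | ref a = subst (_∈ _) (sym (inv-ρ a))
                      (ρ∈⋊⁺ (subst (λ b → (b ∘ invA c) ∈ B) (sym (⁻¹-involutive a)) (ρ∈⋊⁻ x∈)))

  generates⇒rotationParts-generate : ∀ {P c} → ρ c ∈ P → Generatesᴰ P → GeneratesA (rotationParts P c)
  generates⇒rotationParts-generate {P} {c} ρc∈P gen a B B≤A parts⊆B =
    ι∈⋊⁻ (gen (ι a) (B ⋊⟨ρ c ⟩) (⋊-subgroup B≤A) P⊆B⋊)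
    where
    P⊆B⋊ : P ⊆ B ⋊⟨ρ c ⟩
    P⊆B⋊ {u} u∈ with view u
    ... | rot b = ι∈⋊⁺ (parts⊆B (fromDec⁺ (rotationPart? P c) (inj₁ u∈)))
    ... | ref b = ρ∈⋊⁺ (parts⊆B (fromDec⁺ (rotationPart? P c)
                         (inj₂ (subst (_∈ P) (cong ρ (sym (//-rightDividesˡ c b))) u∈))))

  rotationParts-mono : ∀ {P Q c} → P ⊆ Q → rotationParts P c ⊆ rotationParts Q c
  rotationParts-mono {P} {Q} {c} P⊆Q a∈ with fromDec⁻ (rotationPart? P c) a∈
  ... | inj₁ ιa∈ = fromDec⁺ (rotationPart? Q c) (inj₁ (P⊆Q ιa∈))
  ... | inj₂ ρac∈ = fromDec⁺ (rotationPart? Q c) (inj₂ (P⊆Q ρac∈))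

  rotationParts-∪⁅⁆ : ∀ {P u c a} → a ∈ rotationParts (P ∪ ⁅ u ⁆) c
                    → a ∈ rotationParts P c ⊎ (u ≡ ι a ⊎ u ≡ ρ (a ∘ c))
  rotationParts-∪⁅⁆ {P} {u} {c} {a} a∈ with fromDec⁻ (rotationPart? (P ∪ ⁅ u ⁆) c) a∈
  ... | inj₁ ιa∈ with ∈∪⁅⁆⁻ ιa∈
  ...   | inj₁ ιa∈P = inj₁ (fromDec⁺ (rotationPart? P c) (inj₁ ιa∈P))
  ...   | inj₂ ιa≡u = inj₂ (inj₁ (sym ιa≡u))
  rotationParts-∪⁅⁆ {P} {u} {c} {a} a∈ | inj₂ ρac∈ with ∈∪⁅⁆⁻ ρac∈
  ...   | inj₁ ρac∈P = inj₁ (fromDec⁺ (rotationPart? P c) (inj₂ ρac∈P))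
  ...   | inj₂ ρac≡u = inj₂ (inj₂ (sym ρac≡u))

  rotationParts-of-rotations : ∀ {P c c′} → ¬ HasReflection P → rotationParts P c ⊆ rotationParts P c′
  rotationParts-of-rotations {P} {c} {c′} ¬refl a∈ with fromDec⁻ (rotationPart? P c) a∈
  ... | inj₁ ιa∈ = fromDec⁺ (rotationPart? P c′) (inj₁ ιa∈)
  ... | inj₂ ρac∈ = ⊥-elim (¬refl (_ , ρac∈))

  eA∈rotationParts : ∀ {P c} → ρ c ∈ P → eA ∈ rotationParts P c
  eA∈rotationParts {P} {c} ρc∈ =
    fromDec⁺ (rotationPart? P c) (inj₂ (subst (λ b → ρ b ∈ P) (sym (identityˡ c)) ρc∈))

  rotationPart : ∀ c u → ∃ λ w → ∀ {a} → u ≡ ι a ⊎ u ≡ ρ (a ∘ c) → a ≡ w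
  rotationPart c u with view u
  ... | rot b = b , [ (λ ιb≡ιa → sym (ι-injective ιb≡ιa)) , (λ ιb≡ρ → ⊥-elim (ι≢ρ ιb≡ρ)) ]′
  ... | ref v = v ∘ invA c , [ (λ ρv≡ι → ⊥-elim (ι≢ρ (sym ρv≡ι))) , ρ-part ]′
    where
    ρ-part : ∀ {a} → ρ v ≡ ρ (a ∘ c) → a ≡ v ∘ invA c
    ρ-part {a} ρv≡ρac = begin
      a                 ≡⟨ //-rightDividesʳ c a ⟨
      (a ∘ c) ∘ invA c  ≡⟨ cong (_∘ invA c) (ρ-injective ρv≡ρac) ⟨
      v ∘ invA c        ∎

  ¬reflection-∪ι : ∀ {P a} → ¬ HasReflection P → ¬ HasReflection (P ∪ ⁅ ι a ⁆)
  ¬reflection-∪ι ¬refl (b , ρb∈) with ∈∪⁅⁆⁻ ρb∈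
  ... | inj₁ ρb∈P = ¬refl (b , ρb∈P)
  ... | inj₂ ρb≡ιa = ι≢ρ (sym ρb≡ιa)

  reflection-added : ∀ {P g} → ¬ HasReflection P → HasReflection (P ∪ ⁅ g ⁆) → ∃ λ c → g ≡ ρ c
  reflection-added ¬refl (c , ρc∈) with ∈∪⁅⁆⁻ ρc∈
  ... | inj₁ ρc∈P = ⊥-elim (¬refl (c , ρc∈P))
  ... | inj₂ ρc≡g = c , sym ρc≡g

  ¬reflection-∪⟨⟩ : ∀ {P g} → ¬ HasReflection P → _∈⟨_⟩ (Dih _∘_ eA invA) g P → ¬ HasReflection (P ∪ ⁅ g ⁆)
  ¬reflection-∪⟨⟩ ¬refl g∈⟨P⟩ refl′ with reflection-added ¬refl refl′
  ... | c , refl = ρ∉Rotations c (g∈⟨P⟩ Rotations Rotations-subgroup (¬reflection⇒⊆Rotations ¬refl))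

  rotationParts-∪ρ : ∀ {P c c′} → ¬ HasReflection P → rotationParts (P ∪ ⁅ ρ c ⁆) c ⊆ rotationParts (P ∪ ⁅ ρ c′ ⁆) c′
  rotationParts-∪ρ {c = c} ¬refl a∈ with rotationParts-∪⁅⁆ a∈
  ... | inj₁ a∈P = rotationParts-mono ∈∪⁅⁆ˡ (rotationParts-of-rotations ¬refl a∈P)
  ... | inj₂ (inj₁ ρc≡ιa) = ⊥-elim (ι≢ρ (sym ρc≡ιa))
  ... | inj₂ (inj₂ ρc≡ρac) =
    subst (_∈ _) (sym (identityˡ-unique _ c (sym (ρ-injective ρc≡ρac)))) (eA∈rotationParts ∈∪⁅⁆ʳ)

  ¬reflection-∪⁅⁆-generates : ∀ {P g} → ¬ HasReflection P → Generatesᴰ (P ∪ ⁅ g ⁆)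
                             → ∀ c′ → Generatesᴰ (P ∪ ⁅ ρ c′ ⁆)
  ¬reflection-∪⁅⁆-generates {P} {g} ¬refl gen c′ with view g
  ... | rot a = ⊥-elim (¬reflection⇒¬generates (¬reflection-∪ι ¬refl) gen)
  ... | ref c = generated-by-rotationParts ∈∪⁅⁆ʳ (generates⇒rotationParts-generate ∈∪⁅⁆ʳ gen) (rotationParts-∪ρ ¬refl)

  ¬reflection-∪ρ⁅⁆-generates : ∀ {P c h} → ¬ HasReflection P → Generatesᴰ ((P ∪ ⁅ ρ c ⁆) ∪ ⁅ h ⁆)
                              → ∀ c′ → ∃ λ w → Generatesᴰ ((P ∪ ⁅ ρ c′ ⁆) ∪ ⁅ ι w ⁆)
  ¬reflection-∪ρ⁅⁆-generates {P} {c} {h} ¬refl gen c′ with rotationPart c h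
  ... | w , part≡w = w , generated-by-rotationParts (∈∪⁅⁆ˡ ∈∪⁅⁆ʳ)
                           (generates⇒rotationParts-generate (∈∪⁅⁆ˡ ∈∪⁅⁆ʳ) gen) parts⊆
    where
    parts⊆ : rotationParts ((P ∪ ⁅ ρ c ⁆) ∪ ⁅ h ⁆) c ⊆ rotationParts ((P ∪ ⁅ ρ c′ ⁆) ∪ ⁅ ι w ⁆) c′
    parts⊆ a∈ with rotationParts-∪⁅⁆ a∈
    ... | inj₁ a∈′ = rotationParts-mono ∈∪⁅⁆ˡ (rotationParts-∪ρ ¬refl a∈′)
    ... | inj₂ h-part = subst (_∈ _) (sym (part≡w h-part)) (fromDec⁺ (rotationPart? _ c′) (inj₁ ∈∪⁅⁆ʳ))

  ¬reflection-∪⁅⁆⁅⁆-generates : ∀ {P g h} → ¬ HasReflection P → Generatesᴰ ((P ∪ ⁅ g ⁆) ∪ ⁅ h ⁆)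
                               → ∀ c′ → ∃ λ w → Generatesᴰ ((P ∪ ⁅ ρ c′ ⁆) ∪ ⁅ ι w ⁆)
  ¬reflection-∪⁅⁆⁅⁆-generates {P} {g} {h} ¬refl gen with view g | view h
  ... | ref c | _ = ¬reflection-∪ρ⁅⁆-generates ¬refl gen
  ... | rot a | ref c = ¬reflection-∪ρ⁅⁆-generates ¬refl (generates-mono ∪⁅⁆-swap gen)
  ... | rot a | rot b = ⊥-elim (¬reflection⇒¬generates (¬reflection-∪ι (¬reflection-∪ι ¬refl)) gen)

  closed-with-reflection⇒even : ∀ {P} → Closed P → HasReflection P → even ∣ P ∣ ≡ true
  closed-with-reflection⇒even {P} closed (c , ρc∈P) =
    fixedPointFree-involution⇒even ·ρc-involutive P ·ρc-stable ·ρc-free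
    where
    ·ρc-involutive : ∀ u → (u · ρ c) · ρ c ≡ u
    ·ρc-involutive u with view u
    ... | rot a = trans (cong (_· ρ c) (ι·ρ a c)) (trans (ρ·ρ (a ∘ c) c) (cong ι (//-rightDividesʳ c a)))
    ... | ref a = trans (cong (_· ρ c) (ρ·ρ a c)) (trans (ι·ρ (a ∘ invA c) c) (cong ρ (//-rightDividesˡ c a)))
    ·ρc-stable : Stable (_· ρ c) P
    ·ρc-stable u∈ = proj₁ (proj₂ (closed⇒subgroup closed)) _ _ u∈ ρc∈P
    ·ρc-free : FixedPointFree (_· ρ c) P
    ·ρc-free {u} _ with view u
    ... | rot a = λ ρac≡ιa → ι≢ρ (trans (sym ρac≡ιa) (ι·ρ a c))
    ... | ref a = λ ι≡ρa → ι≢ρ (trans (sym (ρ·ρ a c)) ι≡ρa)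

  -- Inversion has the single fixed point e on a subgroup of rotations, by oddness of |A|.
  closed-without-reflection⇒odd : ¬ 2 ∣ n → ∀ {P} → Closed P → ¬ HasReflection P → even ∣ P ∣ ≡ false
  closed-without-reflection⇒odd n-odd {P} closed ¬refl =
    trans (cong even (∣p∣≡1+∣p-x∣ P e∈P)) (cong not ∣P-e∣-even)
    where
    open OddOrder isAbelianGroup n-odd using (square≡e⇒≡e)
    P≤G = closed⇒subgroup closed
    e∈P = proj₁ P≤G
    inv-involutive : ∀ u → inv (inv u) ≡ u
    inv-involutive u with view u
    ... | rot a = trans (cong inv (inv-ι a)) (trans (inv-ι (invA a)) (cong ι (⁻¹-involutive a)))
    ... | ref a = trans (cong inv (inv-ρ a)) (trans (inv-ρ _) (cong ρ (trans (⁻¹-involutive _) (⁻¹-involutive a))))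
    inv-e : inv e ≡ e
    inv-e = trans (inv-ι eA) (cong ι ε⁻¹≈ε)
    inv-stable : Stable inv (P - e)
    inv-stable {u} u∈ = x∈p∧x≢y⇒x∈p-y (proj₂ (proj₂ P≤G) u (x∈p-y⇒x∈p P u∈))
      λ inv-u≡e → x∈p-y⇒x≢y P u∈ (trans (sym (inv-involutive u)) (trans (cong inv inv-u≡e) inv-e))
    inv-free : FixedPointFree inv (P - e)
    inv-free {u} u∈ with view u
    ... | ref a = ⊥-elim (¬refl (a , x∈p-y⇒x∈p P u∈))
    ... | rot a = λ inv-ιa≡ιa → x∈p-y⇒x≢y P u∈ (cong ι (square≡e⇒≡e
                    (trans (cong (a ∘_) (sym (ι-injective (trans (sym (inv-ι a)) inv-ιa≡ιa)))) (inverseʳ a))))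
    ∣P-e∣-even : even ∣ P - e ∣ ≡ true
    ∣P-e∣-even = fixedPointFree-involution⇒even inv-involutive (P - e) inv-stable inv-free

data Kind : Set where
  reflection₁ reflection₂ rotation₁ rotation₂ rotation₃ : Kind

-- The flag is the parity of the position: nimOf k (even ∣ P ∣).
nimOf : Kind → Bool → ℕ
nimOf reflection₁ true  = 1
nimOf reflection₁ false = 2
nimOf reflection₂ true  = 0
nimOf reflection₂ false = 2
nimOf rotation₁   true  = 2
nimOf rotation₁   false = 1
nimOf rotation₂   true  = 3
nimOf rotation₂   false = 0
nimOf rotation₃   true  = 3
nimOf rotation₃   false = 1

closedParity : Kind → Bool
closedParity reflection₁ = true
closedParity reflection₂ = true
closedParity rotation₁   = false
closedParity rotation₂   = false
closedParity rotation₃   = false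

data _⇝_ : Kind → Kind → Set where
  stay    : ∀ {k} → k ⇝ k
  refl₂⇝refl₁ : reflection₂ ⇝ reflection₁
  rot₂⇝rot₁   : rotation₂ ⇝ rotation₁
  rot₂⇝refl₁  : rotation₂ ⇝ reflection₁
  rot₃⇝rot₂   : rotation₃ ⇝ rotation₂
  rot₃⇝refl₂  : rotation₃ ⇝ reflection₂

⇝-nimOf≢ : ∀ {k k′} → k ⇝ k′ → ∀ e → nimOf k e ≢ nimOf k′ (not e)
⇝-nimOf≢ {reflection₁} stay true ()
⇝-nimOf≢ {reflection₁} stay false ()
⇝-nimOf≢ {reflection₂} stay true ()
⇝-nimOf≢ {reflection₂} stay false ()
⇝-nimOf≢ {rotation₁} stay true ()
⇝-nimOf≢ {rotation₁} stay false ()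
⇝-nimOf≢ {rotation₂} stay true ()
⇝-nimOf≢ {rotation₂} stay false ()
⇝-nimOf≢ {rotation₃} stay true ()
⇝-nimOf≢ {rotation₃} stay false ()
⇝-nimOf≢ refl₂⇝refl₁ true ()
⇝-nimOf≢ refl₂⇝refl₁ false ()
⇝-nimOf≢ rot₂⇝rot₁ true ()
⇝-nimOf≢ rot₂⇝rot₁ false ()
⇝-nimOf≢ rot₂⇝refl₁ true ()
⇝-nimOf≢ rot₂⇝refl₁ false ()
⇝-nimOf≢ rot₃⇝rot₂ true ()
⇝-nimOf≢ rot₃⇝rot₂ false ()
⇝-nimOf≢ rot₃⇝refl₂ true ()
⇝-nimOf≢ rot₃⇝refl₂ false ()

Below : (ℕ → Set) → ℕ → Set
Below R v = ∀ m → m < v → R m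

below-0 : ∀ {R} → Below R 0
below-0 _ ()

below-suc : ∀ {R v} → Below R v → R v → Below R (suc v)
below-suc {v = v} below Rv m m<1+v with m<1+n⇒m<n∨m≡n m<1+v
... | inj₁ m<v = below m m<v
... | inj₂ refl = Rv

module Game (G : GroupTable) (f : Subset (GroupTable.N G) → ℕ) (f-nim : IsNim G f) where
  open GroupTable G using (N)
  open Subgroups G

  Option : Subset N → ℕ → Set
  Option P m = ∃ λ g → g ∉ P × f (P ∪ ⁅ g ⁆) ≡ m

  mex-value : ∀ {P} → ¬ Generates G P → ∀ v → (∀ g → g ∉ P → f (P ∪ ⁅ g ⁆) ≢ v) → Below (Option P) v → f P ≡ v
  mex-value {P} ¬gen v no-v below with proj₂ (f-nim P (inj₁ ¬gen)) ¬gen | <-cmp (f P) v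
  ... | options≢ , _ | tri< fP<v _ _ = let (g , g∉ , eq) = below (f P) fP<v in ⊥-elim (options≢ g g∉ eq)
  ... | _ | tri≈ _ fP≡v _ = fP≡v
  ... | _ , options< | tri> _ _ v<fP = let (g , g∉ , eq) = options< v v<fP in ⊥-elim (no-v g g∉ eq)

  terminal-value : ∀ {P g} → ¬ Generates G P → Generates G (P ∪ ⁅ g ⁆) → f (P ∪ ⁅ g ⁆) ≡ 0
  terminal-value {P} {g} ¬gen gen = proj₁ (f-nim (P ∪ ⁅ g ⁆) (inj₂ terminal)) terminal
    where
    P∪g-g⊆P : (P ∪ ⁅ g ⁆) - g ⊆ P
    P∪g-g⊆P x∈ with ∈∪⁅⁆⁻ (x∈p-y⇒x∈p (P ∪ ⁅ g ⁆) x∈)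
    ... | inj₁ x∈P = x∈P
    ... | inj₂ x≡g = ⊥-elim (x∈p-y⇒x≢y (P ∪ ⁅ g ⁆) x∈ x≡g)
    terminal : Terminal G (P ∪ ⁅ g ⁆)
    terminal = gen , g , ∈∪⁅⁆ʳ , λ gen′ → ¬gen (generates-mono P∪g-g⊆P gen′)

  generating-∉ : ∀ {P g} → ¬ Generates G P → Generates G (P ∪ ⁅ g ⁆) → g ∉ P
  generating-∉ ¬gen gen g∈P = ¬gen (generates-mono (∪⁅⁆-absorb g∈P) gen)

  terminal-option : ∀ {P} → ¬ Generates G P → δ≤1 P → Option P 0
  terminal-option ¬gen (g , gen) = g , generating-∉ ¬gen gen , terminal-value ¬gen gen

module DihedralNim {n : ℕ} {_∘_ : Fin n → Fin n → Fin n} {eA : Fin n} {invA : Fin n → Fin n}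
                   (isAbelianGroup : IsAbelianGroup _≡_ _∘_ eA invA) (n-odd : ¬ 2 ∣ n)
                   {a₀ b₀ : Fin n} (a₀b₀-generate : Generates (table _∘_ eA invA) (⁅ a₀ ⁆ ∪ ⁅ b₀ ⁆))
                   (f : Subset (GroupTable.N (Dih _∘_ eA invA)) → ℕ) (f-nim : IsNim (Dih _∘_ eA invA) f) where

  open DihedralGroup isAbelianGroup
  open GroupTable (Dih _∘_ eA invA) using (N)
  open Game (Dih _∘_ eA invA) f f-nim

  reflection-a₀-b₀-generate : ∀ {T c} → ρ c ∈ T → ι a₀ ∈ T → ι b₀ ∈ T → Generatesᴰ T
  reflection-a₀-b₀-generate {T} {c} ρc∈ ιa₀∈ ιb₀∈ = generated-by-rotationParts ρc∈ a₀b₀-generate a₀b₀⊆parts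
    where
    a₀b₀⊆parts : ⁅ a₀ ⁆ ∪ ⁅ b₀ ⁆ ⊆ rotationParts T c
    a₀b₀⊆parts a∈ with ∈∪⁅⁆⁻ a∈
    ... | inj₁ a∈⁅a₀⁆ = fromDec⁺ (rotationPart? T c) (inj₁ (subst (λ a → ι a ∈ T) (sym (x∈⁅y⁆⇒x≡y a₀ a∈⁅a₀⁆)) ιa₀∈))
    ... | inj₂ refl = fromDec⁺ (rotationPart? T c) (inj₁ ιb₀∈)

  reflection⇒δ≤2 : ∀ {P} → HasReflection P → δ≤2 P
  reflection⇒δ≤2 (c , ρc∈) = ι a₀ , ι b₀ , reflection-a₀-b₀-generate (∈∪⁅⁆ˡ (∈∪⁅⁆ˡ ρc∈)) (∈∪⁅⁆ˡ ∈∪⁅⁆ʳ) ∈∪⁅⁆ʳ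

  δ≤2-∪ιa₀ : ∀ P → δ≤2 (P ∪ ⁅ ι a₀ ⁆)
  δ≤2-∪ιa₀ P = ι b₀ , ρ eA , reflection-a₀-b₀-generate ∈∪⁅⁆ʳ (∈∪⁅⁆ˡ (∈∪⁅⁆ˡ ∈∪⁅⁆ʳ)) (∈∪⁅⁆ˡ ∈∪⁅⁆ʳ)

  -- The index of a kind is δ(P): without a reflection, adding ρ e, ι a₀ and ι b₀ always generates.
  data _HasKind_ (P : Subset N) : Kind → Set where
    reflection₁ : HasReflection P → δ≤1 P → P HasKind reflection₁
    reflection₂ : HasReflection P → ¬ δ≤1 P → P HasKind reflection₂
    rotation₁   : ¬ HasReflection P → δ≤1 P → P HasKind rotation₁
    rotation₂   : ¬ HasReflection P → ¬ δ≤1 P → δ≤2 P → P HasKind rotation₂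
    rotation₃   : ¬ HasReflection P → ¬ δ≤2 P → P HasKind rotation₃

  kindOf : ∀ P → ∃ (P HasKind_)
  kindOf P with hasReflection? P | δ≤1? P | δ≤2? P
  ... | yes r | yes d₁ | _     = _ , reflection₁ r d₁
  ... | yes r | no ¬d₁ | _     = _ , reflection₂ r ¬d₁
  ... | no ¬r | yes d₁ | _     = _ , rotation₁ ¬r d₁
  ... | no ¬r | no ¬d₁ | yes d₂ = _ , rotation₂ ¬r ¬d₁ d₂
  ... | no ¬r | no ¬d₁ | no ¬d₂ = _ , rotation₃ ¬r ¬d₂

  reflection-∪⁅⁆ : ∀ {P g} → HasReflection P → HasReflection (P ∪ ⁅ g ⁆)
  reflection-∪⁅⁆ (c , ρc∈) = c , ∈∪⁅⁆ˡ ρc∈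

  HasKind-∪⟨⟩ : ∀ {P g k} → _∈⟨_⟩ (Dih _∘_ eA invA) g P → P HasKind k → (P ∪ ⁅ g ⁆) HasKind k
  HasKind-∪⟨⟩ g∈ (reflection₁ r d₁)     = reflection₁ (reflection-∪⁅⁆ r) (δ≤1-mono ∈∪⁅⁆ˡ d₁)
  HasKind-∪⟨⟩ g∈ (reflection₂ r ¬d₁)    = reflection₂ (reflection-∪⁅⁆ r) (λ d₁ → ¬d₁ (δ≤1-∪⟨⟩⁻ g∈ d₁))
  HasKind-∪⟨⟩ g∈ (rotation₁ ¬r d₁)      = rotation₁ (¬reflection-∪⟨⟩ ¬r g∈) (δ≤1-mono ∈∪⁅⁆ˡ d₁)
  HasKind-∪⟨⟩ g∈ (rotation₂ ¬r ¬d₁ d₂)  =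
    rotation₂ (¬reflection-∪⟨⟩ ¬r g∈) (λ d₁ → ¬d₁ (δ≤1-∪⟨⟩⁻ g∈ d₁)) (δ≤2-mono ∈∪⁅⁆ˡ d₂)
  HasKind-∪⟨⟩ g∈ (rotation₃ ¬r ¬d₂)     = rotation₃ (¬reflection-∪⟨⟩ ¬r g∈) (λ d₂ → ¬d₂ (δ≤2-∪⟨⟩⁻ g∈ d₂))

  closed-parity : ∀ {P k} → Closed P → P HasKind k → even ∣ P ∣ ≡ closedParity k
  closed-parity closed (reflection₁ r _)   = closed-with-reflection⇒even closed r
  closed-parity closed (reflection₂ r _)   = closed-with-reflection⇒even closed r
  closed-parity closed (rotation₁ ¬r _)    = closed-without-reflection⇒odd n-odd closed ¬r
  closed-parity closed (rotation₂ ¬r _ _)  = closed-without-reflection⇒odd n-odd closed ¬r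
  closed-parity closed (rotation₃ ¬r _)    = closed-without-reflection⇒odd n-odd closed ¬r

  δ≤1-nimOf≢0 : ∀ {P k} → P HasKind k → δ≤1 P → ∀ e → nimOf k e ≢ 0
  δ≤1-nimOf≢0 (reflection₁ _ _) _ true   = λ ()
  δ≤1-nimOf≢0 (reflection₁ _ _) _ false  = λ ()
  δ≤1-nimOf≢0 (reflection₂ _ ¬d₁) d₁ _   = contradiction d₁ ¬d₁
  δ≤1-nimOf≢0 (rotation₁ _ _) _ true     = λ ()
  δ≤1-nimOf≢0 (rotation₁ _ _) _ false    = λ ()
  δ≤1-nimOf≢0 (rotation₂ _ ¬d₁ _) d₁ _   = contradiction d₁ ¬d₁
  δ≤1-nimOf≢0 (rotation₃ _ ¬d₂) d₁ _     = contradiction (δ≤1⇒δ≤2 d₁) ¬d₂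

  module _ {P g} (¬gen : ¬ Generatesᴰ (P ∪ ⁅ g ⁆)) where

    private
      Q = P ∪ ⁅ g ⁆

      ¬reflection-∪⁅⁆-δ≤1 : ¬ HasReflection P → HasReflection Q → ¬ δ≤1 P
      ¬reflection-∪⁅⁆-δ≤1 ¬r r′ (_ , gen) with reflection-added ¬r r′
      ... | c , refl = ¬gen (¬reflection-∪⁅⁆-generates ¬r gen c)

      ¬reflection-∪⁅⁆-δ≤2 : ¬ HasReflection P → HasReflection Q → δ≤2 P → δ≤1 Q
      ¬reflection-∪⁅⁆-δ≤2 ¬r r′ (_ , _ , gen) with reflection-added ¬r r′
      ... | c , refl = let (w , gen′) = ¬reflection-∪⁅⁆⁅⁆-generates ¬r gen c in ι w , gen′

    kind-step : ∀ {k k′} → P HasKind k → Q HasKind k′ → k ⇝ k′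
    kind-step (reflection₁ _ _)      (reflection₁ _ _)      = stay
    kind-step (reflection₁ _ d₁)     (reflection₂ _ ¬d₁′)   = contradiction (δ≤1-mono ∈∪⁅⁆ˡ d₁) ¬d₁′
    kind-step (reflection₁ r _)      (rotation₁ ¬r′ _)      = contradiction (reflection-∪⁅⁆ r) ¬r′
    kind-step (reflection₁ r _)      (rotation₂ ¬r′ _ _)    = contradiction (reflection-∪⁅⁆ r) ¬r′
    kind-step (reflection₁ r _)      (rotation₃ ¬r′ _)      = contradiction (reflection-∪⁅⁆ r) ¬r′
    kind-step (reflection₂ _ _)      (reflection₁ _ _)      = refl₂⇝refl₁
    kind-step (reflection₂ _ _)      (reflection₂ _ _)      = stay
    kind-step (reflection₂ r _)      (rotation₁ ¬r′ _)      = contradiction (reflection-∪⁅⁆ r) ¬r′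
    kind-step (reflection₂ r _)      (rotation₂ ¬r′ _ _)    = contradiction (reflection-∪⁅⁆ r) ¬r′
    kind-step (reflection₂ r _)      (rotation₃ ¬r′ _)      = contradiction (reflection-∪⁅⁆ r) ¬r′
    kind-step (rotation₁ ¬r d₁)      (reflection₁ r′ _)     = contradiction d₁ (¬reflection-∪⁅⁆-δ≤1 ¬r r′)
    kind-step (rotation₁ ¬r d₁)      (reflection₂ r′ _)     = contradiction d₁ (¬reflection-∪⁅⁆-δ≤1 ¬r r′)
    kind-step (rotation₁ _ _)        (rotation₁ _ _)        = stay
    kind-step (rotation₁ _ d₁)       (rotation₂ _ ¬d₁′ _)   = contradiction (δ≤1-mono ∈∪⁅⁆ˡ d₁) ¬d₁′
    kind-step (rotation₁ _ d₁)       (rotation₃ _ ¬d₂′)     = contradiction (δ≤1⇒δ≤2 (δ≤1-mono ∈∪⁅⁆ˡ d₁)) ¬d₂′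
    kind-step (rotation₂ _ _ _)      (reflection₁ _ _)      = rot₂⇝refl₁
    kind-step (rotation₂ ¬r _ d₂)    (reflection₂ r′ ¬d₁′)  = contradiction (¬reflection-∪⁅⁆-δ≤2 ¬r r′ d₂) ¬d₁′
    kind-step (rotation₂ _ _ _)      (rotation₁ _ _)        = rot₂⇝rot₁
    kind-step (rotation₂ _ _ _)      (rotation₂ _ _ _)      = stay
    kind-step (rotation₂ _ _ d₂)     (rotation₃ _ ¬d₂′)     = contradiction (δ≤2-mono ∈∪⁅⁆ˡ d₂) ¬d₂′
    kind-step (rotation₃ _ ¬d₂)      (reflection₁ _ d₁′)    = contradiction (δ≤1-∪⁅⁆⇒δ≤2 d₁′) ¬d₂
    kind-step (rotation₃ _ _)        (reflection₂ _ _)      = rot₃⇝refl₂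
    kind-step (rotation₃ _ ¬d₂)      (rotation₁ _ d₁′)      = contradiction (δ≤1-∪⁅⁆⇒δ≤2 d₁′) ¬d₂
    kind-step (rotation₃ _ _)        (rotation₂ _ _ _)      = rot₃⇝rot₂
    kind-step (rotation₃ _ _)        (rotation₃ _ _)        = stay

  module Options {P} (¬gen : ¬ Generatesᴰ P)
    (IH : ∀ {g k} → g ∉ P → ¬ Generatesᴰ (P ∪ ⁅ g ⁆) → (P ∪ ⁅ g ⁆) HasKind k
        → f (P ∪ ⁅ g ⁆) ≡ nimOf k (even ∣ P ∪ ⁅ g ⁆ ∣)) where

    option : ∀ {g k e} → even ∣ P ∣ ≡ e → g ∉ P → ¬ Generatesᴰ (P ∪ ⁅ g ⁆) → (P ∪ ⁅ g ⁆) HasKind k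
           → Option P (nimOf k (not e))
    option {g} {k} refl g∉ ¬gen′ kind′ =
      g , g∉ , trans (IH g∉ ¬gen′ kind′) (cong (λ m → nimOf k (even m)) (∣p∪⁅x⁆∣≡1+∣p∣ g∉))

    -- A position of the wrong parity for a subgroup is not closed, and extending it inside ⟨P⟩ keeps its kind.
    inner-option : ∀ {k e} → even ∣ P ∣ ≡ e → e ≢ closedParity k → P HasKind k → Option P (nimOf k (not e))
    inner-option e-eq e≢ kind with closed-or-extendable P
    ... | inj₁ closed = contradiction (trans (sym e-eq) (closed-parity closed kind)) e≢
    ... | inj₂ (g , g∉ , g∈⟨P⟩) = option e-eq g∉ (λ gen′ → ¬gen (generates-∪⟨⟩⁻ g∈⟨P⟩ gen′)) (HasKind-∪⟨⟩ g∈⟨P⟩ kind)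

    ρe-option : ∀ {k e} → even ∣ P ∣ ≡ e → ¬ HasReflection P → ¬ δ≤1 P → (P ∪ ⁅ ρ eA ⁆) HasKind k
              → Option P (nimOf k (not e))
    ρe-option e-eq ¬r ¬d₁ = option e-eq (λ ρe∈ → ¬r (eA , ρe∈)) (λ gen′ → ¬d₁ (ρ eA , gen′))

    reflection₁-option : ∀ {e} → even ∣ P ∣ ≡ e → HasReflection P → ¬ δ≤1 P → Option P (nimOf reflection₁ (not e))
    reflection₁-option e-eq r ¬d₁ with reflection⇒δ≤2 r
    ... | g , h , gen = option e-eq g∉ (λ gen′ → ¬d₁ (g , gen′)) (reflection₁ (reflection-∪⁅⁆ r) (h , gen))
      where
      g∉ : g ∉ P
      g∉ g∈ = ¬d₁ (h , generates-mono (∪⁅⁆-mono (∪⁅⁆-absorb g∈)) gen)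

    rotation₂-options : ∀ {e} → even ∣ P ∣ ≡ e → ¬ HasReflection P → ¬ δ≤1 P → δ≤2 P
                      → Option P (nimOf rotation₁ (not e)) × Option P (nimOf reflection₁ (not e))
    rotation₂-options e-eq ¬r ¬d₁ (_ , _ , gen₂) with ¬reflection-∪⁅⁆⁅⁆-generates ¬r gen₂ eA
    ... | w , gen = option e-eq ιw∉ (¬reflection⇒¬generates (¬reflection-∪ι ¬r))
                      (rotation₁ (¬reflection-∪ι ¬r) (ρ eA , generates-mono ∪⁅⁆-swap gen))
                  , ρe-option e-eq ¬r ¬d₁ (reflection₁ (eA , ∈∪⁅⁆ʳ) (ι w , gen))
      where
      ιw∉ : ι w ∉ P
      ιw∉ ιw∈ = ¬d₁ (ρ eA , generates-mono (∪⁅⁆-absorb (∈∪⁅⁆ˡ ιw∈)) gen)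

    rotation₃-options : ∀ {e} → even ∣ P ∣ ≡ e → ¬ HasReflection P → ¬ δ≤2 P
                      → Option P (nimOf rotation₂ (not e)) × Option P (nimOf reflection₂ (not e))
    rotation₃-options e-eq ¬r ¬d₂ =
        option e-eq ιa₀∉ (¬reflection⇒¬generates (¬reflection-∪ι ¬r))
          (rotation₂ (¬reflection-∪ι ¬r) (λ d₁ → ¬d₂ (δ≤1-∪⁅⁆⇒δ≤2 d₁)) (δ≤2-∪ιa₀ P))
      , ρe-option e-eq ¬r (λ d₁ → ¬d₂ (δ≤1⇒δ≤2 d₁)) (reflection₂ (eA , ∈∪⁅⁆ʳ) (λ d₁ → ¬d₂ (δ≤1-∪⁅⁆⇒δ≤2 d₁)))
      where
      ιa₀∉ : ι a₀ ∉ P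
      ιa₀∉ ιa₀∈ = ¬d₂ (δ≤2-mono (∪⁅⁆-absorb ιa₀∈) (δ≤2-∪ιa₀ P))

    no-option-of-own-value : ∀ {k} → P HasKind k → ∀ g → g ∉ P → f (P ∪ ⁅ g ⁆) ≢ nimOf k (even ∣ P ∣)
    no-option-of-own-value kind g g∉ f≡ with generates? (P ∪ ⁅ g ⁆)
    ... | yes gen′ = δ≤1-nimOf≢0 kind (g , gen′) (even ∣ P ∣) (trans (sym f≡) (terminal-value ¬gen gen′))
    ... | no ¬gen′ with kindOf (P ∪ ⁅ g ⁆)
    ...   | k′ , kind′ = ⇝-nimOf≢ (kind-step ¬gen′ kind kind′) (even ∣ P ∣)
                           (trans (sym f≡) (proj₂ (proj₂ (option refl g∉ ¬gen′ kind′))))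

    options-below : ∀ {k} → P HasKind k → Below (Option P) (nimOf k (even ∣ P ∣))
    options-below kind with even ∣ P ∣ in e-eq
    options-below (reflection₁ _ d₁) | true = below-suc below-0 (terminal-option ¬gen d₁)
    options-below kind@(reflection₁ _ d₁) | false =
      below-suc (below-suc below-0 (terminal-option ¬gen d₁)) (inner-option e-eq (λ ()) kind)
    options-below (reflection₂ _ _) | true = below-0
    options-below kind@(reflection₂ r ¬d₁) | false =
      below-suc (below-suc below-0 (inner-option e-eq (λ ()) kind)) (reflection₁-option e-eq r ¬d₁)
    options-below kind@(rotation₁ _ d₁) | true =
      below-suc (below-suc below-0 (terminal-option ¬gen d₁)) (inner-option e-eq (λ ()) kind)
    options-below (rotation₁ _ d₁) | false = below-suc below-0 (terminal-option ¬gen d₁)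
    options-below kind@(rotation₂ ¬r ¬d₁ d₂) | true =
      let (option₁ , option₂) = rotation₂-options e-eq ¬r ¬d₁ d₂ in
      below-suc (below-suc (below-suc below-0 (inner-option e-eq (λ ()) kind)) option₁) option₂
    options-below (rotation₂ _ _ _) | false = below-0
    options-below kind@(rotation₃ ¬r ¬d₂) | true =
      let (option₀ , option₂) = rotation₃-options e-eq ¬r ¬d₂ in
      below-suc (below-suc (below-suc below-0 option₀) (inner-option e-eq (λ ()) kind)) option₂
    options-below (rotation₃ ¬r ¬d₂) | false = below-suc below-0 (proj₂ (rotation₃-options e-eq ¬r ¬d₂))

  nim-value : ∀ {P k} → ¬ Generatesᴰ P → P HasKind k → f P ≡ nimOf k (even ∣ P ∣)
  nim-value {P} = <-rec Goal step (N ∸ ∣ P ∣) P refl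
    where
    Goal : ℕ → Set
    Goal j = ∀ P → N ∸ ∣ P ∣ ≡ j → ∀ {k} → ¬ Generatesᴰ P → P HasKind k → f P ≡ nimOf k (even ∣ P ∣)
    step : ∀ j → (∀ {i} → i < j → Goal i) → Goal j
    step _ rec P refl ¬gen kind = mex-value ¬gen _ (no-option-of-own-value kind) (options-below kind)
      where
      smaller : ∀ {g} → g ∉ P → N ∸ ∣ P ∪ ⁅ g ⁆ ∣ < N ∸ ∣ P ∣
      smaller {g} g∉ = ∸-monoʳ-< (subst (∣ P ∣ <_) (sym (∣p∪⁅x⁆∣≡1+∣p∣ g∉)) ≤-refl) (∣p∣≤n (P ∪ ⁅ g ⁆))
      open Options ¬gen (λ {g} g∉ → rec (smaller g∉) (P ∪ ⁅ g ⁆) refl)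

module OddStructureClasses {n : ℕ} {_∘_ : Fin n → Fin n → Fin n} {eA : Fin n} {invA : Fin n → Fin n}
         (isAbelianGroup : IsAbelianGroup _≡_ _∘_ eA invA) (n-odd : Odd n)
         {a₀ b₀ : Fin n} (a₀b₀-generate : Generates (table _∘_ eA invA) (⁅ a₀ ⁆ ∪ ⁅ b₀ ⁆))
         (f : Subset (GroupTable.N (Dih _∘_ eA invA)) → ℕ) (f-nim : IsNim (Dih _∘_ eA invA) f) where

  open DihedralGroup isAbelianGroup public
  open DihedralNim isAbelianGroup n-odd a₀b₀-generate f f-nim public
  open GroupTable (Dih _∘_ eA invA) using (N)

  odd⇒≢⊤ : ∀ {I : Subset N} → Odd ∣ I ∣ → I ≢ ⊤
  odd⇒≢⊤ I-odd refl = I-odd (subst (2 ∣_) (sym (∣⊤∣≡n N)) (m∣m*n n))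

  ∈𝓘-odd⇒¬reflection : ∀ {I} → InI (Dih _∘_ eA invA) I → Odd ∣ I ∣ → ¬ HasReflection I
  ∈𝓘-odd⇒¬reflection (Ms , _ , Ms-max , refl) I-odd r =
    I-odd (even⇒2∣ _ (closed-with-reflection⇒even (subgroup⇒closed (⋂-maximal-subgroup Ms Ms-max)) r))

  odd-class-type : ∀ {I k} → StructIndex (Dih _∘_ eA invA) I → Odd ∣ I ∣
    → (∀ {P} → ¬ HasReflection P → P ⊆ I → (∀ Q → Generatesᴰ (I ∪ Q) → Generatesᴰ (P ∪ Q)) → P HasKind k)
    → HasType (Dih _∘_ eA invA) f I 1 (nimOf k true) (nimOf k false)
  odd-class-type {I} {k} I-index I-odd kind-of-member =
      ¬2∣⇒pty≡1 ∣ I ∣ I-odd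
    , (λ P P∈X P-even → value P P∈X (2∣⇒even ∣ P ∣ P-even))
    , (λ P P∈X P-odd → value P P∈X (¬2∣⇒even≡false ∣ P ∣ P-odd))
    where
    I∈𝓘 : InI (Dih _∘_ eA invA) I
    I∈𝓘 = [ (λ I∈𝓘 → I∈𝓘) , (λ I≡⊤ → ⊥-elim (odd⇒≢⊤ I-odd I≡⊤)) ]′ I-index
    value : ∀ P → InX (Dih _∘_ eA invA) I P → ∀ {e} → even ∣ P ∣ ≡ e → f P ≡ nimOf k e
    value P (inj₁ (I≡⊤ , _)) _ = ⊥-elim (odd⇒≢⊤ I-odd I≡⊤)
    value P (inj₂ (_ , P⊆I , minimal)) refl = nim-value (¬reflection⇒¬generates ¬r) (kind-of-member ¬r P⊆I transfer)
      where
      ¬r : ¬ HasReflection P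
      ¬r (c , ρc∈P) = ∈𝓘-odd⇒¬reflection I∈𝓘 I-odd (c , P⊆I ρc∈P)
      transfer : ∀ Q → Generatesᴰ (I ∪ Q) → Generatesᴰ (P ∪ Q)
      transfer Q = generates-∪-within-structure-class I∈𝓘 P⊆I minimal

lemma5p6 : (n : ℕ) (_∘_ : Fin n → Fin n → Fin n) (eA : Fin n) (invA : Fin n → Fin n)
  → IsAbelianGroup _≡_ _∘_ eA invA
  → Odd n
  → MinGens (table _∘_ eA invA) 2
  → (f : Subset (GroupTable.N (Dih _∘_ eA invA)) → ℕ)
  → IsNim (Dih _∘_ eA invA) f
  → (I : Subset (GroupTable.N (Dih _∘_ eA invA)))
  → StructIndex (Dih _∘_ eA invA) I
  → Odd ∣ I ∣
  → (Deficiency (Dih _∘_ eA invA) I 1 → HasType (Dih _∘_ eA invA) f I 1 2 1)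
  × (Deficiency (Dih _∘_ eA invA) I 2 → HasType (Dih _∘_ eA invA) f I 1 3 0)
  × (Deficiency (Dih _∘_ eA invA) I 3 → HasType (Dih _∘_ eA invA) f I 1 3 1)
lemma5p6 n _∘_ eA invA isAbelianGroup n-odd minGens f f-nim I I-index I-odd
  with Subgroups.minGens-2⇒generating-pair (table _∘_ eA invA) minGens
... | a₀ , b₀ , a₀b₀-generate =
    (λ δ₁ → odd-class-type I-index I-odd λ ¬r _ transfer → rotation₁ ¬r (deficiency-1⇒δ≤1 transfer δ₁))
  , (λ δ₂ → odd-class-type I-index I-odd λ ¬r P⊆I transfer →
              rotation₂ ¬r (deficiency≥2⇒¬δ≤1 P⊆I δ₂ (s≤s (s≤s z≤n))) (deficiency-2⇒δ≤2 transfer δ₂))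
  , (λ δ₃ → odd-class-type I-index I-odd λ ¬r P⊆I _ → rotation₃ ¬r (deficiency-3⇒¬δ≤2 P⊆I δ₃))
  where open OddStructureClasses isAbelianGroup n-odd a₀b₀-generate f f-nim
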